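{- Let $m,g$ be positive integers and let $\mu=(\mu_1\ge\cdots\ge\mu_m\ge 0)$ be a partition contained in the rectangle with $m$ rows and $g$ columns (i.e. $\mu_1\le g$, $\ell(\mu)\le m$). Let $\hat\mu=(g-\mu_m,g-\mu_{m-1},\dots,g-\mu_1)$ be the complement of $\mu$ in this rectangle. Then there exists a crystal-weight-preserving bijection $\Psi_{m,g}$ between the set $K(\mu,m)$ of King tableaux of shape $\mu$ and the set $\mathrm{SSOT}_g(\hat\mu,m)$.
   Context: King tableaux: for an integer $m$, a King tableau of shape $\lambda$ with $\ell(\lambda)\le m$ is a filling of the Young (Ferrers) diagram of $\lambda$ with letters of the alphabet $1<\bar 1<2<\bar 2<\cdots<m<\bar m$ such that (1) entries weakly increase along rows and strictly increase down columns, and (2) all entries in row $i$ are $\ge i$. $K(\lambda,m)$ denotes the set of King tableaux of shape $\lambda$. The (crystal) weight of a King tableau is $(\alpha_1,\dots,\alpha_m)$ where $\alpha_i$ is the number of entries $i$ minus the number of entries $\bar i$. Oscillating horizontal strips: for partitions $\lambda\subset\nu$ with $|\nu|=|\lambda|+1$, let $r(\nu/\lambda)=i$ be the row of the added box and set $r(\lambda/\nu)=-i$. An oscillating horizontal strip of length $\ell\ge 0$ is a sequence of partitions $S=(\lambda_0,\dots,\lambda_\ell)$ such that consecutive partitions differ by adding or removing exactly one box, and the signed row numbers $r(\lambda_p/\lambda_{p-1})$, $p=1,\dots,\ell$, are weakly decreasing (so all additions come before all removals, additions occur in weakly decreasing rows and removals in weakly increasing rows). Write $\mathrm{inside}(S)=\lambda_0$,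 $\mathrm{outside}(S)=\lambda_\ell$, $\mathrm{size}(S)=\ell$. Semistandard oscillating tableaux: a (skew) semistandard oscillating tableau is a sequence $T=(S_1,S_2,\dots)$ of oscillating horizontal strips with $\mathrm{outside}(S_i)=\mathrm{inside}(S_{i+1})$ for all $i$ and $\mathrm{size}(S_k)=0$ for $k$ large; its weight is $(\mathrm{size}(S_1),\mathrm{size}(S_2),\dots)$; $\mathrm{outside}(T)$ is $\mathrm{outside}(S_k)$ for $k$ large. It is an SSOT if $\mathrm{inside}(S_1)=\emptyset$. $c(T)$ is the maximum number of columns of a partition occurring in $T$. $\mathrm{SSOT}_g(\nu,m)$ is the set of SSOTs $T$ with $\mathrm{outside}(T)=\nu$, weight $\alpha$ with $\alpha_i=0$ for $i>m$, and $c(T)\le g$. The crystal weight of $T\in\mathrm{SSOT}_g(\nu,m)$ with weight $\alpha$ is $(\beta_1,\dots,\beta_m)$ with $\beta_i=g-\alpha_i$. Crystal-weight-preserving means the King tableau and its image have the same crystal weight vector in $\mathbb Z^m$. -}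

module Defs where

open import Level using (0ℓ)
open import Data.Nat using (ℕ; zero; suc; _+_; _*_; _∸_; _≤_; _<_; _≥_; _⊔_; _≡ᵇ_)
open import Data.Bool using (Bool; true; false; if_then_else_; _∧_)
open import Data.Integer as ℤ using (ℤ; +_; -_)
open import Data.List using (List; []; _∷_; length; map; concat; reverse; replicate; _++_; foldr)
open import Data.List.Relation.Unary.All using (All)
open import Data.List.Relation.Unary.Linked using (Linked)
open import Data.Vec using (Vec; []; _∷_; tabulate; toList)
import Data.Vec as Vec
open import Data.Fin using (Fin; toℕ)
open import Data.Product using (Σ; ∃; _×_; _,_; proj₁)
open import Data.Unit using (⊤)
open import Data.Empty using (⊥)
open import Relation.Binary.PropositionalEquality using (_≡_; isEquivalence)
open import Relation.Binary.Bundles using (Setoid)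
import Relation.Binary.Construct.On as On

-- Partitions: lists of positive parts, weakly decreasing.
-- (λ₁, λ₂, …) with no trailing zeros, so equality of lists is equality
-- of partitions.

IsPartition : List ℕ → Set
IsPartition λs = Linked _≥_ λs × All (λ x → 0 < x) λs

columns : List ℕ → ℕ
columns []      = 0
columns (x ∷ _) = x

dropZeros : List ℕ → List ℕ
dropZeros []            = []
dropZeros (zero  ∷ xs)  = dropZeros xs
dropZeros (suc x ∷ xs)  = suc x ∷ dropZeros xs

complement : ℕ → ℕ → List ℕ → List ℕ
complement m g μ =
  dropZeros (reverse (map (g ∸_) (μ ++ replicate (m ∸ length μ) 0)))

-- the letter i (bar = false) or ī (bar = true)
record Letter : Set where
  constructor letter
  field
    idx : ℕ
    bar : Bool
open Letter public

-- the total order 1 < 1̄ < 2 < 2̄ < … is the order of these codes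
code : Letter → ℕ
code (letter i false) = 2 * i
code (letter i true)  = suc (2 * i)

_≤L_ : Letter → Letter → Set
a ≤L b = code a ≤ code b

_<L_ : Letter → Letter → Set
a <L b = code a < code b

ColStrict : List Letter → List Letter → Set
ColStrict _        []       = ⊤
ColStrict []       (_ ∷ _)  = ⊥
ColStrict (x ∷ xs) (y ∷ ys) = (x <L y) × ColStrict xs ys

ColsStrict : List (List Letter) → Set
ColsStrict []             = ⊤
ColsStrict (r ∷ [])       = ⊤
ColsStrict (r ∷ r' ∷ rs)  = ColStrict r r' × ColsStrict (r' ∷ rs)

RowsBounded : ℕ → List (List Letter) → Set
RowsBounded i []       = ⊤
RowsBounded i (r ∷ rs) = All (λ x → letter i false ≤L x) r × RowsBounded (suc i) rs

InAlphabet : ℕ → Letter → Set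
InAlphabet m x = 1 ≤ idx x × idx x ≤ m

IsKing : List ℕ → ℕ → List (List Letter) → Set
IsKing λs m rows =
  map length rows ≡ λs
  × All (All (InAlphabet m)) rows
  × All (Linked _≤L_) rows
  × ColsStrict rows
  × RowsBounded 1 rows

KingTableau : List ℕ → ℕ → Set
KingTableau λs m = Σ (List (List Letter)) (IsKing λs m)

countLetter : ℕ → Bool → List Letter → ℕ
countLetter i b [] = 0
countLetter i b (letter j c ∷ xs) =
  (if (i ≡ᵇ j) ∧ eqB b c then 1 else 0) + countLetter i b xs
  where
  eqB : Bool → Bool → Bool
  eqB true  true  = true
  eqB false false = true
  eqB _     _     = false

kingWeight : ∀ {λs} m → KingTableau λs m → Vec ℤ m
kingWeight m (rows , _) = tabulate λ (k : Fin m) →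
  let i = suc (toℕ k) ; es = concat rows in
  + countLetter i false es ℤ.- + countLetter i true es

KingSetoid : List ℕ → ℕ → Setoid 0ℓ 0ℓ
KingSetoid λs m = record
  { Carrier = KingTableau λs m
  ; _≈_ = λ s t → proj₁ s ≡ proj₁ t
  ; isEquivalence = On.isEquivalence proj₁ isEquivalence
  }

data AddBox : ℕ → List ℕ → List ℕ → Set where
  here-new : AddBox 1 [] (1 ∷ [])
  here     : ∀ {x xs} → AddBox 1 (x ∷ xs) (suc x ∷ xs)
  there    : ∀ {i x xs ys} → AddBox i xs ys → AddBox (suc i) (x ∷ xs) (x ∷ ys)

data Step (λs νs : List ℕ) : ℤ → Set where
  add    : ∀ {i} → AddBox i λs νs → Step λs νs (+ i)
  remove : ∀ {i} → AddBox i νs λs → Step λs νs (- (+ i))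

data StepsFrom : ℤ → List ℕ → List (List ℕ) → Set where
  done : ∀ {r λs} → StepsFrom r λs []
  step : ∀ {r r' λs νs νss} → Step λs νs r' → r' ℤ.≤ r →
         StepsFrom r' νs νss → StepsFrom r λs (νs ∷ νss)

-- a strip (λ₀, λ₁, …, λ_ℓ) is stored as λ₀ and the list (λ₁, …, λ_ℓ)
record Strip : Set where
  constructor strip
  field
    inside : List ℕ
    rest   : List (List ℕ)
open Strip public

lastOr : List ℕ → List (List ℕ) → List ℕ
lastOr d []       = d
lastOr d (x ∷ xs) = lastOr x xs

outside : Strip → List ℕ
outside s = lastOr (inside s) (rest s)

size : Strip → ℕ
size s = length (rest s)

partsOf : Strip → List (List ℕ)
partsOf s = inside s ∷ rest s

StepsOK : List ℕ → List (List ℕ) → Set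
StepsOK λs []          = ⊤
StepsOK λs (νs ∷ νss)  = ∃ λ r → Step λs νs r × StepsFrom r νs νss

IsOHS : Strip → Set
IsOHS s = All IsPartition (partsOf s) × StepsOK (inside s) (rest s)

-- Semistandard oscillating tableaux with weight supported on 1..m.
-- Since size(S_k) = 0 for k > m, S_k (k > m) is the trivial strip (outside S_m),
-- so T is determined by (S_1, …, S_m).

Chained : ∀ {n} → List ℕ → Vec Strip n → Set
Chained λs []       = ⊤
Chained λs (s ∷ ss) = inside s ≡ λs × IsOHS s × Chained (outside s) ss

outsideFrom : ∀ {n} → List ℕ → Vec Strip n → List ℕ
outsideFrom λs []       = λs
outsideFrom λs (s ∷ ss) = outsideFrom (outside s) ss

cT : ∀ {n} → Vec Strip n → ℕ
cT T = foldr _⊔_ 0 (map columns (concat (map partsOf (toList T))))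

IsSSOT : ∀ (g : ℕ) (ν : List ℕ) (m : ℕ) → Vec Strip m → Set
IsSSOT g ν m T = Chained [] T × outsideFrom [] T ≡ ν × cT T ≤ g

SSOT : ℕ → List ℕ → ℕ → Set
SSOT g ν m = Σ (Vec Strip m) (IsSSOT g ν m)

ssotWeight : ∀ g {ν} m → SSOT g ν m → Vec ℤ m
ssotWeight g m (T , _) = Vec.map (λ s → + g ℤ.- + size s) T

SSOTSetoid : ℕ → List ℕ → ℕ → Setoid 0ℓ 0ℓ
SSOTSetoid g ν m = record
  { Carrier = SSOT g ν m
  ; _≈_ = λ s t → proj₁ s ≡ proj₁ t
  ; isEquivalence = On.isEquivalence proj₁ isEquivalence
  }

-- Deleting the letters m and m̄ from a King tableau of shape μ leaves a King tableau for m - 1 of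
-- shape κ, and row m can hold no other letters, so κ has at most m - 1 rows. With λ the shape of the
-- letters ≤ m, both λ / κ and μ / λ are horizontal strips. Complementing in the rectangle with g columns
-- (κ in m - 1 rows, λ and μ in m rows) reverses both relations: the complement of λ is a horizontal
-- strip over the complements of κ and of μ. An oscillating horizontal strip adds cells in weakly
-- decreasing rows and then removes cells in weakly increasing rows, so it is determined by its two
-- ends and its largest partition, which is a horizontal strip over both ends. Hence the layer of the
-- letters m, m̄ is exactly one strip from the complement of κ through that of λ to that of μ, and its
-- size 2|λ̂| - |κ̂| - |μ̂| works out to g - #m + #m̄. Induction on m gives the bijection and the weights.
-- Shapes are carried padded with zeros to a fixed number of rows, so that complementing is entrywise.

module Submission where

open import Defs
open import Data.Nat
  using (ℕ; zero; suc; _+_; _*_; _∸_; _≤_; _<_; _≥_; z≤n; s≤s; _<ᵇ_; _≡ᵇ_; _⊔_)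
open import Data.Nat.Properties
open import Data.Nat.ListAction using (sum)
open import Data.Nat.Solver using (module +-*-Solver)
open +-*-Solver using (solve; _:+_; _:=_)
open import Data.Bool using (true; false; if_then_else_; T)
open import Data.Integer as ℤ using (ℤ)
import Data.Integer.Properties as ℤ
open import Data.List
  using (List; []; _∷_; length; map; _++_; replicate; _∷ʳ_; drop; concat; reverse; foldr; filter)
open import Data.List.Properties
  using (++-assoc; ++-identityʳ; map-++; length-++; length-replicate; length-map; concat-++;
         unfold-reverse; filter-++; filter-all; filter-none)
open import Data.Nat.ListAction.Properties using (sum-++)
open import Data.List.Relation.Unary.All as All using (All; []; _∷_)
import Data.List.Relation.Unary.All.Properties as All
open import Data.List.Relation.Unary.Linked as Linked using (Linked; []; [-]; _∷_)
open import Data.Vec as Vec using (Vec; []; _∷_; toList) renaming (_∷ʳ_ to _∷ʳᵥ_)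
import Data.Vec.Properties as Vec
open import Data.Fin as Fin using (Fin; toℕ; inject₁; fromℕ)
open import Data.Fin.Properties using (toℕ-inject₁; toℕ-fromℕ; toℕ<n)
open import Data.Product using (Σ; _×_; _,_; proj₁; proj₂)
open import Data.Unit using (⊤; tt)
open import Data.Empty using (⊥; ⊥-elim)
open import Function.Base using (_∘_)
open import Function.Bundles using (Inverse)
open import Relation.Nullary using (¬_; Dec; yes; no)
open import Relation.Binary.PropositionalEquality

-- Partitions padded with zeros

Decreasing : List ℕ → Set
Decreasing []       = ⊤
Decreasing (x ∷ xs) = columns xs ≤ x × Decreasing xs

dropZeros-after0 : ∀ {xs} → Decreasing (0 ∷ xs) → dropZeros xs ≡ []
dropZeros-after0 {[]}         _       = refl
dropZeros-after0 {zero ∷ xs}  (_ , d) = dropZeros-after0 d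
dropZeros-after0 {suc x ∷ xs} (() , _)

sum-after0 : ∀ {xs} → Decreasing (0 ∷ xs) → sum xs ≡ 0
sum-after0 {[]}         _       = refl
sum-after0 {zero ∷ xs}  (_ , d) = sum-after0 d
sum-after0 {suc x ∷ xs} (() , _)

columns-dropZeros : ∀ {xs} → Decreasing xs → columns (dropZeros xs) ≡ columns xs
columns-dropZeros {[]}         _ = refl
columns-dropZeros {zero ∷ xs}  d rewrite dropZeros-after0 d = refl
columns-dropZeros {suc x ∷ xs} _ = refl

sum-dropZeros : ∀ xs → sum (dropZeros xs) ≡ sum xs
sum-dropZeros []           = refl
sum-dropZeros (zero ∷ xs)  = sum-dropZeros xs
sum-dropZeros (suc x ∷ xs) = cong (suc x +_) (sum-dropZeros xs)

dropZeros-++ : ∀ xs ys → dropZeros (xs ++ ys) ≡ dropZeros xs ++ dropZeros ys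
dropZeros-++ []           ys = refl
dropZeros-++ (zero ∷ xs)  ys = dropZeros-++ xs ys
dropZeros-++ (suc x ∷ xs) ys = cong (suc x ∷_) (dropZeros-++ xs ys)

dropZeros-replicate0 : ∀ k → dropZeros (replicate k 0) ≡ []
dropZeros-replicate0 zero    = refl
dropZeros-replicate0 (suc k) = dropZeros-replicate0 k

dropZeros-positive : ∀ {xs} → All (0 <_) xs → dropZeros xs ≡ xs
dropZeros-positive []                    = refl
dropZeros-positive {suc x ∷ xs} (_ ∷ ps) = cong (suc x ∷_) (dropZeros-positive ps)

dropZeros-∷ʳ0 : ∀ xs → dropZeros (xs ∷ʳ 0) ≡ dropZeros xs
dropZeros-∷ʳ0 xs = trans (dropZeros-++ xs (0 ∷ [])) (++-identityʳ _)

sum-∷ʳ0 : ∀ xs → sum (xs ∷ʳ 0) ≡ sum xs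
sum-∷ʳ0 xs = trans (sum-++ xs (0 ∷ [])) (+-identityʳ _)

linked-cons : ∀ {a ys} → columns ys ≤ a → Linked _≥_ ys → Linked _≥_ (a ∷ ys)
linked-cons {ys = []}    _  _ = [-]
linked-cons {ys = _ ∷ _} le l = le ∷ l

dropZeros-positive-parts : ∀ xs → All (0 <_) (dropZeros xs)
dropZeros-positive-parts []           = []
dropZeros-positive-parts (zero ∷ xs)  = dropZeros-positive-parts xs
dropZeros-positive-parts (suc x ∷ xs) = s≤s z≤n ∷ dropZeros-positive-parts xs

dropZeros-linked : ∀ {xs} → Decreasing xs → Linked _≥_ (dropZeros xs)
dropZeros-linked {[]}         _        = []
dropZeros-linked {zero ∷ xs}  (_ , d)  = dropZeros-linked d
dropZeros-linked {suc x ∷ xs} (le , d) =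
  linked-cons (subst (_≤ suc x) (sym (columns-dropZeros d)) le) (dropZeros-linked d)

dropZeros-partition : ∀ {xs} → Decreasing xs → IsPartition (dropZeros xs)
dropZeros-partition {xs} d = dropZeros-linked d , dropZeros-positive-parts xs

decreasing-bounded : ∀ {x g} → Decreasing x → columns x ≤ g → All (_≤ g) x
decreasing-bounded {[]}     _       _  = []
decreasing-bounded {a ∷ as} (h , d) le = le ∷ decreasing-bounded d (≤-trans h le)

partition-tail : ∀ {x xs} → IsPartition (x ∷ xs) → IsPartition xs
partition-tail (l , _ ∷ ps) = Linked.tail l , ps

partition-columns-tail : ∀ {x xs} → IsPartition (x ∷ xs) → columns xs ≤ x
partition-columns-tail {xs = []}    _           = z≤n
partition-columns-tail {xs = _ ∷ _} (le ∷ _ , _) = le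

partition-decreasing : ∀ {ν} → IsPartition ν → Decreasing ν
partition-decreasing {[]}    _ = tt
partition-decreasing {_ ∷ _} p = partition-columns-tail p , partition-decreasing (partition-tail p)

partition-bounded : ∀ {ν} → IsPartition ν → All (_≤ columns ν) ν
partition-bounded p = decreasing-bounded (partition-decreasing p) ≤-refl


pad : ℕ → List ℕ → List ℕ
pad n x = x ++ replicate (n ∸ length x) 0

length-pad : ∀ n x → length x ≤ n → length (pad n x) ≡ n
length-pad n x le = begin
  length (x ++ replicate (n ∸ length x) 0)       ≡⟨ length-++ x ⟩
  length x + length (replicate (n ∸ length x) 0) ≡⟨ cong (length x +_) (length-replicate (n ∸ length x)) ⟩
  length x + (n ∸ length x)                      ≡⟨ m+[n∸m]≡n le ⟩
  n                                              ∎
  where open ≡-Reasoning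

dropZeros-pad : ∀ n {x} → All (0 <_) x → dropZeros (pad n x) ≡ x
dropZeros-pad n {x} ps = begin
  dropZeros (x ++ replicate (n ∸ length x) 0)                  ≡⟨ dropZeros-++ x _ ⟩
  dropZeros x ++ dropZeros (replicate (n ∸ length x) 0)        ≡⟨ cong₂ _++_ (dropZeros-positive ps) (dropZeros-replicate0 (n ∸ length x)) ⟩
  x ++ []                                                      ≡⟨ ++-identityʳ x ⟩
  x                                                            ∎
  where open ≡-Reasoning

replicate0-after0 : ∀ {xs} → Decreasing (0 ∷ xs) → xs ≡ replicate (length xs) 0
replicate0-after0 {[]}         _       = refl
replicate0-after0 {zero ∷ xs}  (_ , d) = cong (0 ∷_) (replicate0-after0 d)
replicate0-after0 {suc x ∷ xs} (() , _)

pad-dropZeros : ∀ {x n} → Decreasing x → length x ≡ n → pad n (dropZeros x) ≡ x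
pad-dropZeros {[]}         _       refl = refl
pad-dropZeros {zero ∷ xs}  d       refl rewrite dropZeros-after0 d = cong (0 ∷_) (sym (replicate0-after0 d))
pad-dropZeros {suc x ∷ xs} (_ , d) refl = cong (suc x ∷_) (pad-dropZeros d refl)

replicate0-∷ʳ : ∀ k → replicate (suc k) 0 ≡ replicate k 0 ∷ʳ 0
replicate0-∷ʳ zero    = refl
replicate0-∷ʳ (suc k) = cong (0 ∷_) (replicate0-∷ʳ k)

pad-suc : ∀ n x → length x ≤ n → pad (suc n) x ≡ pad n x ∷ʳ 0
pad-suc n x le rewrite +-∸-assoc 1 le | replicate0-∷ʳ (n ∸ length x) =
  sym (++-assoc x (replicate (n ∸ length x) 0) (0 ∷ []))

decreasing-++replicate0 : ∀ {xs} k → Decreasing xs → Decreasing (xs ++ replicate k 0)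
decreasing-++replicate0 {[]}         k             _        = replicate0 k
  where
  replicate0 : ∀ k → Decreasing (replicate k 0)
  replicate0 zero          = tt
  replicate0 (suc zero)    = z≤n , tt
  replicate0 (suc (suc k)) = z≤n , replicate0 (suc k)
decreasing-++replicate0 {x ∷ []}     zero          d        = d
decreasing-++replicate0 {x ∷ []}     (suc k)       _        = z≤n , decreasing-++replicate0 {[]} (suc k) tt
decreasing-++replicate0 {x ∷ y ∷ ys} k             (le , d) = le , decreasing-++replicate0 k d

pad-decreasing : ∀ n {ν} → IsPartition ν → Decreasing (pad n ν)
pad-decreasing n p = decreasing-++replicate0 _ (partition-decreasing p)

columns-pad : ∀ n ν → columns (pad n ν) ≤ columns ν
columns-pad n []      with n ∸ 0
... | zero  = z≤n
... | suc _ = z≤n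
columns-pad n (x ∷ _) = ≤-refl

data AddCell : ℕ → List ℕ → List ℕ → Set where
  here  : ∀ {x xs} → AddCell 1 (x ∷ xs) (suc x ∷ xs)
  there : ∀ {i x xs ys} → AddCell i xs ys → AddCell (suc i) (x ∷ xs) (x ∷ ys)

AddCell-sum : ∀ {i x y} → AddCell i x y → sum y ≡ suc (sum x)
AddCell-sum here                = refl
AddCell-sum {x = a ∷ _} (there p) = trans (cong (a +_) (AddCell-sum p)) (+-suc a _)

AddCell-length : ∀ {i x y} → AddCell i x y → length y ≡ length x
AddCell-length here      = refl
AddCell-length (there p) = cong suc (AddCell-length p)

AddCell-row-positive : ∀ {i x y} → AddCell i x y → 1 ≤ i
AddCell-row-positive here      = s≤s z≤n
AddCell-row-positive (there _) = s≤s z≤n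

AddCell-columns : ∀ {i x y} → AddCell i x y → columns x ≤ columns y
AddCell-columns here      = n≤1+n _
AddCell-columns (there _) = ≤-refl

AddCell-drop : ∀ {i x y} → AddCell i x y → drop i x ≡ drop i y
AddCell-drop here      = refl
AddCell-drop (there p) = AddCell-drop p

AddCell⇒AddBox : ∀ {i x y} → AddCell i x y → Decreasing x → Decreasing y →
                 AddBox i (dropZeros x) (dropZeros y)
AddCell⇒AddBox (here {zero})  d _ rewrite dropZeros-after0 d = here-new
AddCell⇒AddBox (here {suc _}) _ _ = here
AddCell⇒AddBox (there {x = zero} p) _ dy with trans (sym (sum-after0 dy)) (AddCell-sum p)
... | ()
AddCell⇒AddBox (there {x = suc _} p) (_ , dx) (_ , dy) = there (AddCell⇒AddBox p dx dy)

AddBox⇒AddCell : ∀ {i x ν} → Decreasing x → AddBox i (dropZeros x) ν → IsPartition ν → i ≤ length x →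
                 Σ (List ℕ) λ y → AddCell i x y × ν ≡ dropZeros y × Decreasing y
AddBox⇒AddCell {x = []} _ here-new _ ()
AddBox⇒AddCell {x = zero ∷ xs} d ab p le with dropZeros xs | dropZeros-after0 d
AddBox⇒AddCell {x = zero ∷ xs} d here-new p le | .[] | refl =
  1 ∷ xs , here , cong (1 ∷_) (sym (dropZeros-after0 d)) , (≤-trans (proj₁ d) z≤n , proj₂ d)
AddBox⇒AddCell {x = suc a ∷ xs} (h , d) here _ _ =
  suc (suc a) ∷ xs , here , refl , (≤-trans h (n≤1+n _) , d)
AddBox⇒AddCell {x = suc a ∷ xs} (h , d) (there ab) p (s≤s le)
  with AddBox⇒AddCell d ab (partition-tail p) le
... | y , ac , refl , dy =
  suc a ∷ y , there ac , refl , (subst (_≤ suc a) (columns-dropZeros dy) (partition-columns-tail p) , dy)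

RemoveBox⇒AddCell : ∀ {i x ν} → Decreasing x → AddBox i ν (dropZeros x) → IsPartition ν →
                    Σ (List ℕ) λ y → AddCell i y x × ν ≡ dropZeros y × Decreasing y
RemoveBox⇒AddCell {x = []} _ () _
RemoveBox⇒AddCell {x = zero ∷ xs} d ab p with dropZeros xs | dropZeros-after0 d
RemoveBox⇒AddCell {x = zero ∷ xs} d () p | .[] | refl
RemoveBox⇒AddCell {x = suc a ∷ xs} (h , d) ab p with dropZeros xs in eq
RemoveBox⇒AddCell {x = suc zero ∷ xs} (h , d) here-new p | .[] =
  0 ∷ xs , here , sym eq ,
  (subst (_≤ 0) (sym (trans (sym (columns-dropZeros d)) (cong columns eq))) z≤n , d)
RemoveBox⇒AddCell {x = suc zero ∷ xs} (h , d) here (_ , () ∷ _) | _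
RemoveBox⇒AddCell {x = suc (suc a) ∷ xs} (h , d) here p | _ =
  suc a ∷ xs , here , cong (suc a ∷_) (sym eq) ,
  (subst (_≤ suc a) (trans (cong columns (sym eq)) (columns-dropZeros d)) (partition-columns-tail p) , d)
RemoveBox⇒AddCell {x = suc a ∷ xs} (h , d) (there ab) p | _
  with RemoveBox⇒AddCell d (subst (AddBox _ _) (sym eq) ab) (partition-tail p)
... | y , ac , refl , dy = suc a ∷ y , there ac , refl , (≤-trans (AddCell-columns ac) h , dy)

-- Chains of single-cell moves

data SignedRow : Set where
  up down : ℕ → SignedRow

-- the order of ℤ on the signed rows +i and -i
infix 4 _≼_

_≼_ : SignedRow → SignedRow → Set
up i   ≼ up j   = i ≤ j
up _   ≼ down _ = ⊥
down _ ≼ up _   = ⊤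
down i ≼ down j = j ≤ i

≼-trans : ∀ {a b c} → a ≼ b → b ≼ c → a ≼ c
≼-trans {up _}   {up _}   {up _}   p q = ≤-trans p q
≼-trans {down _} {up _}   {up _}   _ _ = tt
≼-trans {down _} {down _} {up _}   _ _ = tt
≼-trans {down _} {down _} {down _} p q = ≤-trans q p
≼-trans {down _} {up _}   {down _} _ ()

toℤ : SignedRow → ℤ
toℤ (up i)   = ℤ.+ i
toℤ (down i) = ℤ.- (ℤ.+ i)

data Chain : SignedRow → List ℕ → List (List ℕ) → Set where
  []ᶜ  : ∀ {s x} → Chain s x []
  addᶜ : ∀ {s i x y L} → AddCell i x y → up i ≼ s → Chain (up i) y L → Chain s x (y ∷ L)
  remᶜ : ∀ {s i x y L} → AddCell i y x → down i ≼ s → Chain (down i) y L → Chain s x (y ∷ L)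

Chain-weaken : ∀ {s s' x L} → s ≼ s' → Chain s x L → Chain s' x L
Chain-weaken _  []ᶜ          = []ᶜ
Chain-weaken le (addᶜ p l c) = addᶜ p (≼-trans l le) c
Chain-weaken le (remᶜ p l c) = remᶜ p (≼-trans l le) c

Chain-length : ∀ {s x L} → Chain s x L → length (lastOr x L) ≡ length x
Chain-length []ᶜ          = refl
Chain-length (addᶜ p _ c) = trans (Chain-length c) (AddCell-length p)
Chain-length (remᶜ p _ c) = trans (Chain-length c) (sym (AddCell-length p))

≼⇒≤ : ∀ {a b} → a ≼ b → toℤ a ℤ.≤ toℤ b
≼⇒≤ {up _}         {up _}         le       = ℤ.+≤+ le
≼⇒≤ {down zero}    {up _}         _        = ℤ.+≤+ z≤n
≼⇒≤ {down (suc _)} {up _}         _        = ℤ.-≤+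
≼⇒≤ {down zero}    {down zero}    _        = ℤ.+≤+ z≤n
≼⇒≤ {down (suc _)} {down zero}    _        = ℤ.-≤+
≼⇒≤ {down (suc _)} {down (suc _)} (s≤s le) = ℤ.-≤- le

≤⇒down≼ : ∀ {i s} → 1 ≤ i → ℤ.- (ℤ.+ i) ℤ.≤ toℤ s → down i ≼ s
≤⇒down≼ {s = up _}             _ _          = tt
≤⇒down≼ {suc _} {down zero}    _ _          = z≤n
≤⇒down≼ {suc _} {down (suc _)} _ (ℤ.-≤- le) = s≤s le

≤⇒up≼ : ∀ {i s} → 1 ≤ i → ℤ.+ i ℤ.≤ toℤ s → up i ≼ s
≤⇒up≼ {s = up _}             _ (ℤ.+≤+ le) = le
≤⇒up≼ {suc _} {down zero}    _ (ℤ.+≤+ ())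
≤⇒up≼ {suc _} {down (suc _)} _ ()

Chain⇒StepsFrom : ∀ {s x L} → Chain s x L → Decreasing x → All Decreasing L →
                  StepsFrom (toℤ s) (dropZeros x) (map dropZeros L)
Chain⇒StepsFrom []ᶜ _ _ = done
Chain⇒StepsFrom (addᶜ p le c) dx (dy ∷ dL) =
  step (add (AddCell⇒AddBox p dx dy)) (≼⇒≤ le) (Chain⇒StepsFrom c dy dL)
Chain⇒StepsFrom (remᶜ p le c) dx (dy ∷ dL) =
  step (remove (AddCell⇒AddBox p dy dx)) (≼⇒≤ le) (Chain⇒StepsFrom c dy dL)

AddBox-row-positive : ∀ {i a b} → AddBox i a b → 1 ≤ i
AddBox-row-positive here-new  = s≤s z≤n
AddBox-row-positive here      = s≤s z≤n
AddBox-row-positive (there _) = s≤s z≤n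

-- the row of an addition must exist in the padded partition
RoomFor : SignedRow → List ℕ → Set
RoomFor (up i)   x = i ≤ length x
RoomFor (down _) _ = ⊤

StepsFrom⇒Chain : ∀ s {x νss} → StepsFrom (toℤ s) (dropZeros x) νss → Decreasing x → RoomFor s x →
                  All IsPartition νss →
                  Σ (List (List ℕ)) λ L → Chain s x L × νss ≡ map dropZeros L × All Decreasing L
StepsFrom⇒Chain s done _ _ _ = [] , []ᶜ , refl , []
StepsFrom⇒Chain (up j) (step (add {i} ab) le st) dx room (p ∷ ps)
  with ≤⇒up≼ {s = up j} (AddBox-row-positive ab) le
... | i≤j with AddBox⇒AddCell dx ab p (≤-trans i≤j room)
... | y , ac , refl , dy
  with StepsFrom⇒Chain (up i) st dy (subst (i ≤_) (sym (AddCell-length ac)) (≤-trans i≤j room)) ps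
... | L , c , refl , dL = y ∷ L , addᶜ ac i≤j c , refl , dy ∷ dL
StepsFrom⇒Chain (down j) (step (add ab) le _) _ _ _ = ⊥-elim (≤⇒up≼ {s = down j} (AddBox-row-positive ab) le)
StepsFrom⇒Chain s (step (remove {i} ab) le st) dx _ (p ∷ ps) with RemoveBox⇒AddCell dx ab p
... | y , ac , refl , dy with StepsFrom⇒Chain (down i) st dy tt ps
... | L , c , refl , dL = y ∷ L , remᶜ ac (≤⇒down≼ (AddBox-row-positive ab) le) c , refl , dy ∷ dL

-- Canonical oscillating strips

-- x ≺ y : y / x is a horizontal strip, both padded to the same length
infix 4 _≺_

_≺_ : List ℕ → List ℕ → Set
[]       ≺ []       = ⊤
[]       ≺ (_ ∷ _)  = ⊥
(_ ∷ _)  ≺ []       = ⊥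
(a ∷ as) ≺ (p ∷ ps) = a ≤ p × columns ps ≤ a × as ≺ ps

≺-refl : ∀ {x} → Decreasing x → x ≺ x
≺-refl {[]}     _       = tt
≺-refl {a ∷ as} (h , d) = ≤-refl , h , ≺-refl d

≺-columns : ∀ {x y} → x ≺ y → columns x ≤ columns y
≺-columns {[]}    {[]}    _        = z≤n
≺-columns {_ ∷ _} {_ ∷ _} (le , _) = le

≺-decreasingʳ : ∀ {x y} → x ≺ y → Decreasing y
≺-decreasingʳ {[]}     {[]}     _             = tt
≺-decreasingʳ {a ∷ as} {p ∷ ps} (le , h , il) = ≤-trans h le , ≺-decreasingʳ il

≺-decreasingˡ : ∀ {x y} → x ≺ y → Decreasing x
≺-decreasingˡ {[]}     {[]}     _            = tt
≺-decreasingˡ {_ ∷ _}  {_ ∷ _}  (_ , h , il) = ≤-trans (≺-columns il) h , ≺-decreasingˡ il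

≺-bounded : ∀ {x y g} → x ≺ y → All (_≤ g) y → All (_≤ g) x
≺-bounded {[]}     {[]}     _            _        = []
≺-bounded {a ∷ as} {p ∷ ps} (le , _ , il) (b ∷ bs) = ≤-trans le b ∷ ≺-bounded il bs

raiseHead : ℕ → ℕ → List ℕ → List (List ℕ)
raiseHead a zero    ps = []
raiseHead a (suc k) ps = (suc a ∷ ps) ∷ raiseHead (suc a) k ps

lowerHead : ℕ → ℕ → List ℕ → List (List ℕ)
lowerHead b zero    ps = []
lowerHead b (suc k) ps = ((b + k) ∷ ps) ∷ lowerHead b k ps

-- growing x to π cell by cell, bottom row first
additions : List ℕ → List ℕ → List (List ℕ)
additions []       _        = []
additions (a ∷ as) []       = []
additions (a ∷ as) (p ∷ ps) = map (a ∷_) (additions as ps) ++ raiseHead a (p ∸ a) ps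

-- shrinking π to β cell by cell, top row first
removals : List ℕ → List ℕ → List (List ℕ)
removals []       _        = []
removals (p ∷ ps) []       = []
removals (p ∷ ps) (b ∷ bs) = lowerHead b (p ∸ b) ps ++ map (b ∷_) (removals ps bs)

canonical : List ℕ → List ℕ → List ℕ → List (List ℕ)
canonical α π β = additions α π ++ removals π β

additions-self : ∀ xs → additions xs xs ≡ []
additions-self []       = refl
additions-self (a ∷ as) rewrite additions-self as | n∸n≡0 a = refl

removals-self : ∀ xs → removals xs xs ≡ []
removals-self []       = refl
removals-self (a ∷ as) rewrite removals-self as | n∸n≡0 a = refl

canonical-self : ∀ x β → canonical x x β ≡ removals x β
canonical-self x β = cong (_++ removals x β) (additions-self x)

SameBefore : ℕ → List ℕ → List ℕ → Set
SameBefore (suc (suc i)) (a ∷ as) (b ∷ bs) = a ≡ b × SameBefore (suc i) as bs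
SameBefore _             _        _        = ⊤

SameBefore-refl : ∀ i x → SameBefore i x x
SameBefore-refl zero          _        = tt
SameBefore-refl (suc zero)    _        = tt
SameBefore-refl (suc (suc i)) []       = tt
SameBefore-refl (suc (suc i)) (a ∷ as) = refl , SameBefore-refl (suc i) as

SameBefore-mono : ∀ {i j x β} → j ≤ i → SameBefore i x β → SameBefore j x β
SameBefore-mono {j = zero}     _ _ = tt
SameBefore-mono {j = suc zero} _ _ = tt
SameBefore-mono {suc (suc i)} {suc (suc j)} {[]}     _ _ = tt
SameBefore-mono {suc (suc i)} {suc (suc j)} {_ ∷ _} {[]} _ _ = tt
SameBefore-mono {suc (suc i)} {suc (suc j)} {_ ∷ _} {_ ∷ _} (s≤s le) (e , s) = e , SameBefore-mono le s
SameBefore-mono {suc zero} {suc (suc j)} (s≤s ()) _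

∸-suc : ∀ a p → suc a ≤ p → p ∸ a ≡ suc (p ∸ suc a)
∸-suc zero    (suc p) _        = refl
∸-suc (suc a) (suc p) (s≤s le) = ∸-suc a p le

removals-step : ∀ {i y x β} → AddCell i y x → SameBefore i y β → β ≺ y →
                removals x β ≡ y ∷ removals y β
removals-step {β = []}    here _ ()
removals-step {y = c ∷ _} {β = b ∷ _} here _ (le , _ , _)
  rewrite ∸-suc b (suc c) (s≤s le) | m+[n∸m]≡n le = refl
removals-step {β = []} (there _) _ ()
removals-step {suc zero} (there ()) _ _
removals-step {suc (suc i)} {a ∷ _} {a ∷ _} {_ ∷ _} (there p) (refl , s) (_ , _ , il)
  rewrite n∸n≡0 a | removals-step p s il = refl

≺-removal : ∀ {i y x β} → AddCell i y x → SameBefore i y β → β ≺ y → Decreasing x → β ≺ x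
≺-removal {β = []} here _ () _
≺-removal {β = _ ∷ _} here _ (le , h , il) _ = ≤-trans le (n≤1+n _) , h , il
≺-removal {β = []} (there _) _ () _
≺-removal {suc zero} (there ()) _ _ _
≺-removal {suc (suc i)} {_ ∷ _} {_ ∷ _} {_ ∷ _} (there p) (refl , s) (_ , _ , il) (h , dx) =
  ≤-refl , h , ≺-removal p s il dx

SameBefore-removal : ∀ {i y x β} → AddCell i y x → SameBefore i y β → SameBefore i x β
SameBefore-removal here _ = tt
SameBefore-removal {β = []} (there here)      _ = tt
SameBefore-removal {β = []} (there (there _)) _ = tt
SameBefore-removal {suc zero} (there ()) _
SameBefore-removal {suc (suc i)} {β = _ ∷ _} (there p) (e , s) = e , SameBefore-removal p s

down-chain-canonical : ∀ {j x L β} → Chain (down j) x L → All Decreasing L → Decreasing x →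
                       lastOr x L ≡ β → L ≡ removals x β × β ≺ x × SameBefore j x β
down-chain-canonical {j} {x} []ᶜ _ dx refl = sym (removals-self x) , ≺-refl dx , SameBefore-refl j x
down-chain-canonical (addᶜ _ () _) _ _ _
down-chain-canonical (remᶜ p le c) (dy ∷ dL) dx e with down-chain-canonical c dL dy e
... | refl , il , s =
  sym (removals-step p s il) , ≺-removal p s il dx , SameBefore-mono le (SameBefore-removal p s)

additions-step : ∀ {i x y π} → AddCell i x y → drop i y ≡ drop i π → y ≺ π →
                 additions x π ≡ y ∷ additions y π
additions-step {π = []} here _ ()
additions-step {x = a ∷ xs} {π = p ∷ _} here refl (le , _ , _)
  rewrite additions-self xs | ∸-suc a p le = refl
additions-step {π = []} (there _) _ ()
additions-step {π = _ ∷ _} (there q) e (_ , _ , il) rewrite additions-step q e il = refl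

≺-addition : ∀ {i x y π} → AddCell i x y → drop i y ≡ drop i π → y ≺ π → Decreasing x → x ≺ π
≺-addition {π = []} here _ () _
≺-addition {π = _ ∷ _} here refl (le , _ , il) (h , _) = ≤-trans (n≤1+n _) le , h , il
≺-addition {π = []} (there _) _ () _
≺-addition {π = _ ∷ _} (there q) e (le , h , il) (_ , dx) = le , h , ≺-addition q e il dx

drop-mono : ∀ {i j} {x π : List ℕ} → length x ≡ length π → drop i x ≡ drop i π → i ≤ j →
            drop j x ≡ drop j π
drop-mono {zero} {j} _ e _ = cong (drop j) e
drop-mono {suc i} {suc j} {[]}    {[]}    _ _ _        = refl
drop-mono {suc i} {suc j} {_ ∷ _} {_ ∷ _} l e (s≤s le) = drop-mono (suc-injective l) e le

chain-canonical : ∀ {j x L β} → Chain (up j) x L → All Decreasing L → Decreasing x →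
                  lastOr x L ≡ β →
                  Σ (List ℕ) λ π → L ≡ canonical x π β × x ≺ π × β ≺ π
                                 × drop j x ≡ drop j π × length π ≡ length x
chain-canonical {x = x} []ᶜ _ dx refl =
  x , sym (trans (canonical-self x x) (removals-self x)) , ≺-refl dx , ≺-refl dx , refl , refl
chain-canonical {x = x} (remᶜ p le c) (dy ∷ dL) dx e with down-chain-canonical c dL dy e
... | refl , il , s =
  x , trans (sym (removals-step p s il)) (sym (canonical-self x _)) , ≺-refl dx ,
  ≺-removal p s il dx , refl , refl
chain-canonical (addᶜ p le c) (dy ∷ dL) dx e with chain-canonical c dL dy e
... | π , refl , ilyπ , ilβ , dr , len =
  π , cong (_++ removals π _) (sym (additions-step p dr ilyπ)) , ≺-addition p dr ilyπ dx , ilβ ,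
  drop-mono (sym (trans len (AddCell-length p))) (trans (AddCell-drop p) dr) le ,
  trans len (AddCell-length p)

-- κ ∷ʳ 0 ≺ λ says λᵢ₊₁ ≤ κᵢ, which is λ ≺ κ with κ shifted down one row
≺-shift : ∀ {κ lm c} → κ ∷ʳ 0 ≺ lm → columns lm ≤ c → lm ≺ c ∷ κ
≺-shift {[]}    {_ ∷ []}     _            h  = h , z≤n , tt
≺-shift {_ ∷ _} {_ ∷ _}      (le , h' , il) h = h , le , ≺-shift il h'

≺-length : ∀ {x y} → x ≺ y → length x ≡ length y
≺-length {[]}    {[]}    _            = refl
≺-length {_ ∷ _} {_ ∷ _} (_ , _ , il) = cong suc (≺-length il)

data AdditionRun : ℕ → List ℕ → List (List ℕ) → List ℕ → Set where
  []ᵃ  : ∀ {j x} → AdditionRun j x [] x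
  _∷ᵃ_ : ∀ {i j x y L z} → AddCell i x y × i ≤ j → AdditionRun i y L z → AdditionRun j x (y ∷ L) z

AdditionRun-weaken : ∀ {j j' x L z} → j ≤ j' → AdditionRun j x L z → AdditionRun j' x L z
AdditionRun-weaken _   []ᵃ              = []ᵃ
AdditionRun-weaken le' ((p , le) ∷ᵃ a) = (p , ≤-trans le le') ∷ᵃ a

AdditionRun-++ : ∀ {j x L y M z} → 1 ≤ j → AdditionRun j x L y → AdditionRun 1 y M z →
                 AdditionRun j x (L ++ M) z
AdditionRun-++ pos []ᵃ              m = AdditionRun-weaken pos m
AdditionRun-++ _   ((p , le) ∷ᵃ a) m = (p , le) ∷ᵃ AdditionRun-++ (AddCell-row-positive p) a m

AdditionRun-map : ∀ {j xs L zs} a → AdditionRun j xs L zs →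
                  AdditionRun (suc j) (a ∷ xs) (map (a ∷_) L) (a ∷ zs)
AdditionRun-map a []ᵃ              = []ᵃ
AdditionRun-map a ((p , le) ∷ᵃ r) = (there p , s≤s le) ∷ᵃ AdditionRun-map a r

raiseHead-run : ∀ a k ps → AdditionRun 1 (a ∷ ps) (raiseHead a k ps) ((a + k) ∷ ps)
raiseHead-run a zero    ps rewrite +-identityʳ a = []ᵃ
raiseHead-run a (suc k) ps rewrite +-suc a k     = (here , ≤-refl) ∷ᵃ raiseHead-run (suc a) k ps

additions-run : ∀ {x π} → x ≺ π → AdditionRun (length x) x (additions x π) π
additions-run {[]}     {[]}     _            = []ᵃ
additions-run {a ∷ as} {p ∷ ps} (le , _ , il) =
  AdditionRun-++ (s≤s z≤n) (AdditionRun-map a (additions-run il))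
    (subst (λ q → AdditionRun 1 (a ∷ ps) (raiseHead a (p ∸ a) ps) (q ∷ ps)) (m+[n∸m]≡n le)
           (raiseHead-run a (p ∸ a) ps))

AdditionRun-++-Chain : ∀ {j x L y M} → AdditionRun j x L y → (∀ k → Chain (up k) y M) →
                       Chain (up j) x (L ++ M)
AdditionRun-++-Chain {j} []ᵃ              k = k j
AdditionRun-++-Chain ((p , le) ∷ᵃ a) k = addᶜ p le (AdditionRun-++-Chain a k)

shiftRow : SignedRow → SignedRow
shiftRow (up i)   = up (suc i)
shiftRow (down i) = down (suc i)

shiftRow-mono : ∀ {a b} → a ≼ b → shiftRow a ≼ shiftRow b
shiftRow-mono {up _}   {up _}   le = s≤s le
shiftRow-mono {down _} {up _}   _  = tt
shiftRow-mono {down _} {down _} le = s≤s le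

Chain-map : ∀ {s xs L} a → Chain s xs L → Chain (shiftRow s) (a ∷ xs) (map (a ∷_) L)
Chain-map a []ᶜ          = []ᶜ
Chain-map a (addᶜ p le c) = addᶜ (there p) (shiftRow-mono le) (Chain-map a c)
Chain-map a (remᶜ p le c) = remᶜ (there p) (shiftRow-mono le) (Chain-map a c)

lowerHead-++-Chain : ∀ b k ps {M} → Chain (down 1) (b ∷ ps) M →
                     Chain (down 1) ((b + k) ∷ ps) (lowerHead b k ps ++ M)
lowerHead-++-Chain b zero    ps c rewrite +-identityʳ b = c
lowerHead-++-Chain b (suc k) ps c rewrite +-suc b k     = remᶜ here ≤-refl (lowerHead-++-Chain b k ps c)

removals-chain : ∀ {β π} → β ≺ π → Chain (down 1) π (removals π β)
removals-chain {[]}     {[]}     _            = []ᶜ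
removals-chain {b ∷ bs} {p ∷ ps} (le , _ , il) =
  subst (λ q → Chain (down 1) (q ∷ ps) (lowerHead b (p ∸ b) ps ++ map (b ∷_) (removals ps bs)))
        (m+[n∸m]≡n le)
        (lowerHead-++-Chain b (p ∸ b) ps (Chain-weaken (s≤s z≤n) (Chain-map b (removals-chain il))))

canonical-chain : ∀ {α π β} → α ≺ π → β ≺ π → Chain (up (length α)) α (canonical α π β)
canonical-chain ilα ilβ = AdditionRun-++-Chain (additions-run ilα) (λ _ → Chain-weaken tt (removals-chain ilβ))

DecreasingBelow : ℕ → List ℕ → Set
DecreasingBelow p z = Decreasing z × columns z ≤ p

raiseHead-decreasing : ∀ a k ps p → columns ps ≤ a → Decreasing ps → a + k ≤ p →
                       All (DecreasingBelow p) (raiseHead a k ps)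
raiseHead-decreasing a zero    ps p _ _ _  = []
raiseHead-decreasing a (suc k) ps p h d le =
  ((≤-trans h (n≤1+n _) , d) , ≤-trans (s≤s (m≤m+n a k)) (subst (_≤ p) (+-suc a k) le))
  ∷ raiseHead-decreasing (suc a) k ps p (≤-trans h (n≤1+n _)) d (subst (_≤ p) (+-suc a k) le)

additions-decreasing : ∀ {x π} → x ≺ π → Decreasing π → All (DecreasingBelow (columns π)) (additions x π)
additions-decreasing {[]}     {[]}     _             _        = []
additions-decreasing {a ∷ as} {p ∷ ps} (le , h , il) (_ , dπ) =
  All.++⁺ (All.map⁺ (All.map (λ { (dz , hz) → (≤-trans hz h , dz) , le }) (additions-decreasing il dπ)))
          (raiseHead-decreasing a (p ∸ a) ps p h dπ (≤-reflexive (m+[n∸m]≡n le)))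

lowerHead-decreasing : ∀ b k ps → columns ps ≤ b → Decreasing ps → All (DecreasingBelow (b + k)) (lowerHead b k ps)
lowerHead-decreasing b zero    ps _ _ = []
lowerHead-decreasing b (suc k) ps h d =
  ((≤-trans h (m≤m+n b k) , d) , b+k≤b+1+k)
  ∷ All.map (λ { (dz , c) → dz , ≤-trans c b+k≤b+1+k }) (lowerHead-decreasing b k ps h d)
  where
  b+k≤b+1+k : b + k ≤ b + suc k
  b+k≤b+1+k = +-monoʳ-≤ b (n≤1+n k)

removals-decreasing : ∀ {β π} → β ≺ π → Decreasing π → All (DecreasingBelow (columns π)) (removals π β)
removals-decreasing {[]}     {[]}     _             _        = []
removals-decreasing {b ∷ bs} {p ∷ ps} (le , h , il) (_ , dπ) =
  All.++⁺ (subst (λ q → All (DecreasingBelow q) (lowerHead b (p ∸ b) ps)) (m+[n∸m]≡n le)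
                 (lowerHead-decreasing b (p ∸ b) ps h dπ))
          (All.map⁺ (All.map (λ { (dz , hz) → (≤-trans hz h , dz) , le }) (removals-decreasing il dπ)))

canonical-decreasing : ∀ {α π β} → α ≺ π → β ≺ π → All (DecreasingBelow (columns π)) (canonical α π β)
canonical-decreasing ilα ilβ =
  All.++⁺ (additions-decreasing ilα (≺-decreasingʳ ilα)) (removals-decreasing ilβ (≺-decreasingʳ ilα))

peak : List ℕ → List (List ℕ) → List ℕ
peak d []       = d
peak d (y ∷ ys) = if sum d <ᵇ sum y then peak y ys else d

n<ᵇ1+n : ∀ n → (n <ᵇ suc n) ≡ true
n<ᵇ1+n zero    = refl
n<ᵇ1+n (suc n) = n<ᵇ1+n n

1+n<ᵇn : ∀ n → (suc n <ᵇ n) ≡ false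
1+n<ᵇn zero    = refl
1+n<ᵇn (suc n) = 1+n<ᵇn n

peak-AdditionRun : ∀ {j x L y} M → AdditionRun j x L y →
                   peak (dropZeros x) (map dropZeros (L ++ M)) ≡ peak (dropZeros y) (map dropZeros M)
peak-AdditionRun M []ᵃ = refl
peak-AdditionRun {x = x} M (_∷ᵃ_ {y = y} (p , _) a)
  rewrite sum-dropZeros x | sum-dropZeros y | AddCell-sum p | n<ᵇ1+n (sum x) = peak-AdditionRun M a

peak-down-chain : ∀ {j x M} → Chain (down j) x M → peak (dropZeros x) (map dropZeros M) ≡ dropZeros x
peak-down-chain []ᶜ = refl
peak-down-chain (addᶜ _ () _)
peak-down-chain {x = x} (remᶜ {y = y} p _ _)
  rewrite sum-dropZeros x | sum-dropZeros y | AddCell-sum p | 1+n<ᵇn (sum y) = refl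

peak-canonical : ∀ {α π β} → α ≺ π → β ≺ π →
                 peak (dropZeros α) (map dropZeros (canonical α π β)) ≡ dropZeros π
peak-canonical ilα ilβ = trans (peak-AdditionRun _ (additions-run ilα)) (peak-down-chain (removals-chain ilβ))

lastOr-map-dropZeros : ∀ x L → lastOr (dropZeros x) (map dropZeros L) ≡ dropZeros (lastOr x L)
lastOr-map-dropZeros x []      = refl
lastOr-map-dropZeros x (y ∷ L) = lastOr-map-dropZeros y L

lastOr-++ : ∀ (x : List ℕ) L M → lastOr x (L ++ M) ≡ lastOr (lastOr x L) M
lastOr-++ x []      M = refl
lastOr-++ x (y ∷ L) M = lastOr-++ y L M

lastOr-map-∷ : ∀ a (x : List ℕ) L → lastOr (a ∷ x) (map (a ∷_) L) ≡ a ∷ lastOr x L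
lastOr-map-∷ a x []      = refl
lastOr-map-∷ a x (y ∷ L) = lastOr-map-∷ a y L

lastOr-All : ∀ {Q : List ℕ → Set} x L → All Q (x ∷ L) → Q (lastOr x L)
lastOr-All x []      (q ∷ _)  = q
lastOr-All x (y ∷ L) (_ ∷ qs) = lastOr-All y L qs

AdditionRun-last : ∀ {j x L y} → AdditionRun j x L y → lastOr x L ≡ y
AdditionRun-last []ᵃ       = refl
AdditionRun-last (_ ∷ᵃ a) = AdditionRun-last a

lowerHead-last : ∀ b k ps → lastOr ((b + k) ∷ ps) (lowerHead b k ps) ≡ b ∷ ps
lowerHead-last b zero    ps rewrite +-identityʳ b = refl
lowerHead-last b (suc k) ps = lowerHead-last b k ps

removals-last : ∀ {β π} → β ≺ π → lastOr π (removals π β) ≡ β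
removals-last {[]}     {[]}     _            = refl
removals-last {b ∷ bs} {p ∷ ps} (le , _ , il) = begin
  lastOr (p ∷ ps) (lowerHead b (p ∸ b) ps ++ map (b ∷_) (removals ps bs))
    ≡⟨ lastOr-++ (p ∷ ps) (lowerHead b (p ∸ b) ps) _ ⟩
  lastOr (lastOr (p ∷ ps) (lowerHead b (p ∸ b) ps)) (map (b ∷_) (removals ps bs))
    ≡⟨ cong (λ q → lastOr q (map (b ∷_) (removals ps bs))) headLowered ⟩
  lastOr (b ∷ ps) (map (b ∷_) (removals ps bs))
    ≡⟨ lastOr-map-∷ b ps (removals ps bs) ⟩
  b ∷ lastOr ps (removals ps bs)
    ≡⟨ cong (b ∷_) (removals-last il) ⟩
  b ∷ bs
    ∎
  where
  open ≡-Reasoning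
  headLowered : lastOr (p ∷ ps) (lowerHead b (p ∸ b) ps) ≡ b ∷ ps
  headLowered = subst (λ q → lastOr (q ∷ ps) (lowerHead b (p ∸ b) ps) ≡ b ∷ ps)
                      (m+[n∸m]≡n le) (lowerHead-last b (p ∸ b) ps)

canonical-last : ∀ {α π β} → α ≺ π → β ≺ π → lastOr α (canonical α π β) ≡ β
canonical-last {α} {π} ilα ilβ =
  trans (lastOr-++ α (additions α π) _)
        (trans (cong (λ q → lastOr q (removals π _)) (AdditionRun-last (additions-run ilα))) (removals-last ilβ))

AdditionRun-sum : ∀ {j x L y} → AdditionRun j x L y → sum y ≡ length L + sum x
AdditionRun-sum []ᵃ = refl
AdditionRun-sum {x = x} (_∷ᵃ_ {L = L} (p , _) a) =
  trans (AdditionRun-sum a) (trans (cong (length L +_) (AddCell-sum p)) (+-suc (length L) (sum x)))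

down-chain-sum : ∀ {j x M} → Chain (down j) x M → length M + sum (lastOr x M) ≡ sum x
down-chain-sum []ᶜ = refl
down-chain-sum (addᶜ _ () _)
down-chain-sum (remᶜ p _ c) = trans (cong suc (down-chain-sum c)) (sym (AddCell-sum p))

-- Sequences of strips

Vec-eta : ∀ {X : Set} {n} (v : Vec X (suc n)) → v ≡ Vec.init v ∷ʳᵥ Vec.last v
Vec-eta v = proj₂ (proj₂ (Vec.initLast v))

outsideFrom-∷ʳ : ∀ {n} l (T : Vec Strip n) s → outsideFrom l (T ∷ʳᵥ s) ≡ outside s
outsideFrom-∷ʳ l []      s = refl
outsideFrom-∷ʳ l (t ∷ T) s = outsideFrom-∷ʳ (outside t) T s

Chained-∷ʳ⁻ : ∀ {n} l (T : Vec Strip n) s → Chained l (T ∷ʳᵥ s) →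
              Chained l T × inside s ≡ outsideFrom l T × IsOHS s
Chained-∷ʳ⁻ l []      s (e , o , _) = tt , e , o
Chained-∷ʳ⁻ l (t ∷ T) s (e , o , c) with Chained-∷ʳ⁻ (outside t) T s c
... | c' , e' , o' = (e , o , c') , e' , o'

Chained-∷ʳ⁺ : ∀ {n} l (T : Vec Strip n) s → Chained l T → inside s ≡ outsideFrom l T → IsOHS s →
              Chained l (T ∷ʳᵥ s)
Chained-∷ʳ⁺ l []      s _           e o = e , o , tt
Chained-∷ʳ⁺ l (t ∷ T) s (e , o , c) e' o' = e , o , Chained-∷ʳ⁺ (outside t) T s c e' o'

foldr-⊔-≤⁻ : ∀ {g} xs → foldr _⊔_ 0 xs ≤ g → All (_≤ g) xs
foldr-⊔-≤⁻ []       _  = []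
foldr-⊔-≤⁻ (x ∷ xs) le = ≤-trans (m≤m⊔n x _) le ∷ foldr-⊔-≤⁻ xs (≤-trans (m≤n⊔m x _) le)

foldr-⊔-≤⁺ : ∀ {g} xs → All (_≤ g) xs → foldr _⊔_ 0 xs ≤ g
foldr-⊔-≤⁺ []       _        = z≤n
foldr-⊔-≤⁺ (_ ∷ xs) (p ∷ ps) = ⊔-lub p (foldr-⊔-≤⁺ xs ps)

partsList : ∀ {n} → Vec Strip n → List (List ℕ)
partsList T = concat (map partsOf (toList T))

partsList-∷ʳ : ∀ {n} (T : Vec Strip n) s → partsList (T ∷ʳᵥ s) ≡ partsList T ++ partsOf s
partsList-∷ʳ T s rewrite Vec.toList-∷ʳ s T | map-++ partsOf (toList T) (s ∷ []) =
  trans (sym (concat-++ (map partsOf (toList T)) (partsOf s ∷ [])))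
        (cong (partsList T ++_) (++-identityʳ (partsOf s)))

ColumnsAtMost : ℕ → List (List ℕ) → Set
ColumnsAtMost g = All (λ p → columns p ≤ g)

cT≤⇒ColumnsAtMost : ∀ {n g} (T : Vec Strip n) → cT T ≤ g → ColumnsAtMost g (partsList T)
cT≤⇒ColumnsAtMost T le = All.map⁻ (foldr-⊔-≤⁻ (map columns (partsList T)) le)

ColumnsAtMost⇒cT≤ : ∀ {n g} (T : Vec Strip n) → ColumnsAtMost g (partsList T) → cT T ≤ g
ColumnsAtMost⇒cT≤ T ok = foldr-⊔-≤⁺ (map columns (partsList T)) (All.map⁺ ok)

cT-∷ʳ⁻ : ∀ {n g} (T : Vec Strip n) s → cT (T ∷ʳᵥ s) ≤ g → cT T ≤ g × ColumnsAtMost g (partsOf s)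
cT-∷ʳ⁻ T s le with subst (ColumnsAtMost _) (partsList-∷ʳ T s) (cT≤⇒ColumnsAtMost (T ∷ʳᵥ s) le)
... | ok = ColumnsAtMost⇒cT≤ T (All.++⁻ˡ (partsList T) ok) , All.++⁻ʳ (partsList T) ok

cT-∷ʳ⁺ : ∀ {n g} (T : Vec Strip n) s → cT T ≤ g → ColumnsAtMost g (partsOf s) → cT (T ∷ʳᵥ s) ≤ g
cT-∷ʳ⁺ T s le ok =
  ColumnsAtMost⇒cT≤ (T ∷ʳᵥ s) (subst (ColumnsAtMost _) (sym (partsList-∷ʳ T s)) (All.++⁺ (cT≤⇒ColumnsAtMost T le) ok))

AddBox-length : ∀ {i l ν} → AddBox i l ν → length ν ≤ suc (length l)
AddBox-length here-new   = ≤-refl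
AddBox-length here       = n≤1+n _
AddBox-length (there ab) = s≤s (AddBox-length ab)

AddBox-row≤ : ∀ {i l ν} → AddBox i l ν → i ≤ length ν
AddBox-row≤ here-new   = ≤-refl
AddBox-row≤ here       = s≤s z≤n
AddBox-row≤ (there ab) = s≤s (AddBox-row≤ ab)

AddBox-old-row : ∀ {i l ν} → AddBox i l ν → i ≤ length l → length ν ≡ length l
AddBox-old-row here       _        = refl
AddBox-old-row (there ab) (s≤s le) = cong suc (AddBox-old-row ab le)

RemoveBox-length : ∀ {i l ν} → AddBox i ν l → length ν ≤ length l
RemoveBox-length here-new   = z≤n
RemoveBox-length here       = ≤-refl
RemoveBox-length (there ab) = s≤s (RemoveBox-length ab)

-ℤ≤+ℤ : ∀ i k → ℤ.- (ℤ.+ i) ℤ.≤ ℤ.+ k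
-ℤ≤+ℤ zero    _ = ℤ.+≤+ z≤n
-ℤ≤+ℤ (suc _) _ = ℤ.-≤+

StepsFrom-length : ∀ {r l νs} → StepsFrom r l νs → r ℤ.≤ ℤ.+ (length l) → length (lastOr l νs) ≤ length l
StepsFrom-length done _ = ≤-refl
StepsFrom-length (step {νs = ν} {νss = νss} (add ab) le st) b with ℤ.≤-trans le b
... | ℤ.+≤+ il = subst (length (lastOr ν νss) ≤_) (AddBox-old-row ab il)
                       (StepsFrom-length st (ℤ.+≤+ (≤-trans il (≤-reflexive (sym (AddBox-old-row ab il))))))
StepsFrom-length (step (remove {i} ab) _ st) _ = ≤-trans (StepsFrom-length st (-ℤ≤+ℤ i _)) (RemoveBox-length ab)

IsOHS-length : ∀ s → IsOHS s → length (outside s) ≤ suc (length (inside s))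
IsOHS-length (strip l [])      _                             = n≤1+n _
IsOHS-length (strip l (_ ∷ _)) (_ , (_ , add ab , st))       =
  ≤-trans (StepsFrom-length st (ℤ.+≤+ (AddBox-row≤ ab))) (AddBox-length ab)
IsOHS-length (strip l (_ ∷ _)) (_ , (_ , remove {i} ab , st)) =
  ≤-trans (StepsFrom-length st (-ℤ≤+ℤ i _)) (≤-trans (RemoveBox-length ab) (n≤1+n _))

Chained-length : ∀ {n} l (T : Vec Strip n) → Chained l T → length (outsideFrom l T) ≤ length l + n
Chained-length l []      _              = ≤-reflexive (sym (+-identityʳ _))
Chained-length l (t ∷ T) (refl , o , c) =
  ≤-trans (Chained-length (outside t) T c) (≤-trans (+-monoˡ-≤ _ (IsOHS-length t o)) (≤-reflexive (sym (+-suc _ _))))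

IsSSOT-∷ʳ⁺ : ∀ {g ν n} (T : Vec Strip n) s → IsSSOT g ν n T → IsOHS s → inside s ≡ ν →
             ColumnsAtMost g (partsOf s) → IsSSOT g (outside s) (suc n) (T ∷ʳᵥ s)
IsSSOT-∷ʳ⁺ T s (ch , out , ct) o e cols =
  Chained-∷ʳ⁺ [] T s ch (trans e (sym out)) o , outsideFrom-∷ʳ [] T s , cT-∷ʳ⁺ T s ct cols

IsSSOT-∷ʳ⁻ : ∀ {g ν n} (T : Vec Strip n) s → IsSSOT g ν (suc n) (T ∷ʳᵥ s) →
             IsSSOT g (outsideFrom [] T) n T × IsOHS s × inside s ≡ outsideFrom [] T × outside s ≡ ν
             × ColumnsAtMost g (partsOf s)
IsSSOT-∷ʳ⁻ T s (ch , out , ct) with Chained-∷ʳ⁻ [] T s ch | cT-∷ʳ⁻ T s ct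
... | ch' , e , o | ct' , cols = (ch' , refl , ct') , o , e , trans (sym (outsideFrom-∷ʳ [] T s)) out , cols

canonicalStrip : List ℕ → List ℕ → List ℕ → Strip
canonicalStrip α π β = strip (dropZeros α) (map dropZeros (canonical α π β))

StepsFrom⇒StepsOK : ∀ {r l νs} → StepsFrom r l νs → StepsOK l νs
StepsFrom⇒StepsOK done                         = tt
StepsFrom⇒StepsOK (step {r' = r'} st _ sf) = r' , st , sf

canonicalStrip-IsOHS : ∀ {α π β} → α ≺ π → β ≺ π → IsOHS (canonicalStrip α π β)
canonicalStrip-IsOHS ilα ilβ =
  (dropZeros-partition dα ∷ All.map⁺ (All.map dropZeros-partition dL)) ,
  StepsFrom⇒StepsOK (Chain⇒StepsFrom (canonical-chain ilα ilβ) dα dL)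
  where
  dα = ≺-decreasingˡ ilα
  dL = All.map proj₁ (canonical-decreasing ilα ilβ)

canonicalStrip-columns : ∀ {g α π β} → α ≺ π → β ≺ π → columns π ≤ g →
                         ColumnsAtMost g (partsOf (canonicalStrip α π β))
canonicalStrip-columns {g} ilα ilβ bπ =
  subst (_≤ g) (sym (columns-dropZeros (≺-decreasingˡ ilα))) (≤-trans (≺-columns ilα) bπ) ∷
  All.map⁺ (All.map (λ { (d , h) → subst (_≤ g) (sym (columns-dropZeros d)) (≤-trans h bπ) })
                    (canonical-decreasing ilα ilβ))

canonicalStrip-outside : ∀ {α π β} → α ≺ π → β ≺ π → outside (canonicalStrip α π β) ≡ dropZeros β
canonicalStrip-outside {α} {π} {β} ilα ilβ =
  trans (lastOr-map-dropZeros α (canonical α π β)) (cong dropZeros (canonical-last ilα ilβ))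

length-canonical : ∀ {α π β} → α ≺ π → β ≺ π → length (canonical α π β) + sum α + sum β ≡ sum π + sum π
length-canonical {α} {π} {β} ilα ilβ = begin
  length (additions α π ++ removals π β) + sum α + sum β ≡⟨ cong (λ k → k + sum α + sum β) (length-++ (additions α π)) ⟩
  A + R + sum α + sum β                                 ≡⟨ solve 4 (λ A R a b → A :+ R :+ a :+ b := (A :+ a) :+ (R :+ b)) refl A R (sum α) (sum β) ⟩
  (A + sum α) + (R + sum β)                             ≡⟨ cong₂ _+_ (sym (AdditionRun-sum (additions-run ilα))) removed ⟩
  sum π + sum π                                         ∎
  where
  open ≡-Reasoning
  A = length (additions α π)
  R = length (removals π β)
  removed : R + sum β ≡ sum π
  removed = trans (cong (λ x → R + sum x) (sym (removals-last ilβ))) (down-chain-sum (removals-chain ilβ))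

canonical-peak-bounded : ∀ {Q : List ℕ → Set} {α π β} → α ≺ π → All Q (α ∷ canonical α π β) → Q π
canonical-peak-bounded {Q} {α} {π} ilα (q ∷ qs) =
  subst Q (AdditionRun-last (additions-run ilα)) (lastOr-All α (additions α π) (q ∷ All.++⁻ˡ (additions α π) qs))

-- the padding of α leaves room for a new row, so every addition is in a row ≤ length α
StepsOK⇒Chain : ∀ {α νs} → StepsOK (dropZeros α) νs → All IsPartition νs → Decreasing α →
                length (dropZeros α) < length α →
                Σ (List (List ℕ)) λ L → Chain (up (length α)) α L × νs ≡ map dropZeros L × All Decreasing L
StepsOK⇒Chain {α} {[]}     _            _  _  _  = [] , []ᶜ , refl , []
StepsOK⇒Chain {α} {ν ∷ νs} (r , st , sf) ps dα lt =
  StepsFrom⇒Chain (up (length α)) (step st (bound st) sf) dα ≤-refl ps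
  where
  bound : ∀ {r} → Step (dropZeros α) ν r → r ℤ.≤ ℤ.+ (length α)
  bound (add ab)        = ℤ.+≤+ (≤-trans (AddBox-row≤ ab) (≤-trans (AddBox-length ab) lt))
  bound (remove {i} ab) = -ℤ≤+ℤ i _

IsOHS-canonical : ∀ {g} S α β → IsOHS S → ColumnsAtMost g (partsOf S) →
                  inside S ≡ dropZeros α → outside S ≡ dropZeros β →
                  Decreasing α → Decreasing β → length β ≡ length α → length (dropZeros α) < length α →
                  Σ (List ℕ) λ π → S ≡ canonicalStrip α π β × α ≺ π × β ≺ π × columns π ≤ g
IsOHS-canonical {g} (strip l νs) α β (_ ∷ ps , ok) cs refl outE dα dβ lβ lt with StepsOK⇒Chain ok ps dα lt
... | L , c , refl , dL with chain-canonical c dL dα lastE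
  where
  lastE : lastOr α L ≡ β
  lastE = begin
    lastOr α L                               ≡⟨ pad-dropZeros (lastOr-All α L (dα ∷ dL)) (trans (Chain-length c) (sym lβ)) ⟨
    pad (length β) (dropZeros (lastOr α L))  ≡⟨ cong (pad (length β)) (trans (sym (lastOr-map-dropZeros α L)) outE) ⟩
    pad (length β) (dropZeros β)             ≡⟨ pad-dropZeros dβ refl ⟩
    β                                        ∎
    where open ≡-Reasoning
... | π , refl , ilα , ilβ , _ , _ =
  π , refl , ilα , ilβ ,
  canonical-peak-bounded ilα (All.zipWith (λ { (d , c) → subst (_≤ g) (columns-dropZeros d) c })
                                          (dα ∷ dL , All.map⁻ cs))

-- Peeling off the letters n + 1 and n + 1 bar

*2-suc : ∀ n → 2 * suc n ≡ suc (suc (2 * n))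
*2-suc n = *-suc 2 n

2*-cancel-≤ : ∀ i j → 2 * i ≤ suc (2 * j) → i ≤ j
2*-cancel-≤ i j le with i ≤? j
... | yes p = p
... | no p  = ⊥-elim (1+n≰n (≤-pred (subst (_≤ suc (2 * j)) (*2-suc j) (≤-trans (*-monoʳ-≤ 2 (≰⇒> p)) le))))

code-≥ : ∀ e → 2 * idx e ≤ code e
code-≥ (letter _ false) = ≤-refl
code-≥ (letter _ true)  = n≤1+n _

code-≤ : ∀ e → code e ≤ suc (2 * idx e)
code-≤ (letter _ false) = n≤1+n _
code-≤ (letter _ true)  = ≤-refl

≤L⇒idx≤ : ∀ {e f} → e ≤L f → idx e ≤ idx f
≤L⇒idx≤ {e} {f} le = 2*-cancel-≤ (idx e) (idx f) (≤-trans (code-≥ e) (≤-trans le (code-≤ f)))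

top topBar : ℕ → Letter
top    n = letter (suc n) false
topBar n = letter (suc n) true

Below : ℕ → Letter → Set
Below n e = idx e ≤ n

below<top : ∀ {n e} → Below n e → e <L top n
below<top {n} {e} le =
  ≤-trans (s≤s (≤-trans (code-≤ e) (s≤s (*-monoʳ-≤ 2 le)))) (≤-reflexive (sym (*2-suc n)))

below<topBar : ∀ {n e} → Below n e → e <L topBar n
below<topBar {n} {e} le = ≤-trans (below<top {n} {e} le) (n≤1+n _)

top≰below : ∀ {n e} → Below n e → ¬ (top n ≤L e)
top≰below {n} {e} lo le = <-irrefl refl (<-≤-trans (below<top {n} {e} lo) le)

topPart : ℕ → ℕ → ℕ → List Letter
topPart n a b = replicate a (top n) ++ replicate b (topBar n)

RowSplit : ℕ → List Letter → Set
RowSplit n r = Σ (List Letter) λ p → Σ ℕ λ a → Σ ℕ λ b → r ≡ p ++ topPart n a b × All (Below n) p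

FirstAtLeast : Letter → List Letter → Set
FirstAtLeast e []      = ⊤
FirstAtLeast e (x ∷ _) = e ≤L x

linked⇒FirstAtLeast : ∀ {e r} → Linked _≤L_ (e ∷ r) → FirstAtLeast e r
linked⇒FirstAtLeast {r = []}    _        = tt
linked⇒FirstAtLeast {r = _ ∷ _} (le ∷ _) = le

rowSplit-cons-top : ∀ n c p a b → FirstAtLeast (letter (suc n) c) (p ++ topPart n a b) →
                    All (Below n) p → RowSplit n (letter (suc n) c ∷ (p ++ topPart n a b))
rowSplit-cons-top n c     (x ∷ p) a       b le (lx ∷ _) =
  ⊥-elim (<⇒≱ (s≤s lx) (≤L⇒idx≤ {letter (suc n) c} {x} le))
rowSplit-cons-top n false []      a       b _  []       = [] , suc a , b , refl , []
rowSplit-cons-top n true  []      zero    b _  []       = [] , 0 , suc b , refl , []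
rowSplit-cons-top n true  []      (suc a) b le []       = ⊥-elim (<-irrefl refl le)

rowSplit : ∀ n r → Linked _≤L_ r → All (λ e → idx e ≤ suc n) r → RowSplit n r
rowSplit n []      _ _         = [] , 0 , 0 , refl , []
rowSplit n (e ∷ r) s (ie ∷ ir) with rowSplit n r (Linked.tail s) ir
... | p , a , b , refl , lp with idx e ≤? n
...   | yes lo = e ∷ p , a , b , refl , lo ∷ lp
rowSplit n (letter j c ∷ _) s (ie ∷ _) | p , a , b , refl , lp | no hi
  with ≤-antisym ie (≰⇒> hi)
... | refl = rowSplit-cons-top n c p a b (linked⇒FirstAtLeast s) lp

colStrict-bars⇒ : ∀ n q b b' → All (_<L topBar n) q →
                  ColStrict (q ++ replicate b (topBar n)) (replicate b' (topBar n)) → b' ≤ length q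
colStrict-bars⇒ n q       b       zero     _        _        = z≤n
colStrict-bars⇒ n (_ ∷ q) b       (suc b') (_ ∷ lq) (_ , cs) = s≤s (colStrict-bars⇒ n q b b' lq cs)
colStrict-bars⇒ n []      (suc b) (suc b') _        (lt , _) = ⊥-elim (<-irrefl refl lt)

colStrict-bars⇐ : ∀ n q b b' → All (_<L topBar n) q → b' ≤ length q →
                  ColStrict (q ++ replicate b (topBar n)) (replicate b' (topBar n))
colStrict-bars⇐ n q       b zero     _         _        = tt
colStrict-bars⇐ n (_ ∷ q) b (suc b') (lx ∷ lq) (s≤s le) = lx , colStrict-bars⇐ n q b b' lq le

<topBar-++tops : ∀ n p a → All (Below n) p → All (_<L topBar n) (p ++ replicate a (top n))
<topBar-++tops n []      zero    _         = []
<topBar-++tops n []      (suc a) _         = ≤-refl ∷ <topBar-++tops n [] a []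
<topBar-++tops n (x ∷ p) a       (lx ∷ lp) = below<topBar {n} {x} lx ∷ <topBar-++tops n p a lp

length-++tops : ∀ n (p : List Letter) a → length (p ++ replicate a (top n)) ≡ length p + a
length-++tops n p a = trans (length-++ p) (cong (length p +_) (length-replicate a))

colStrict-top⇒ : ∀ n p a b a' b' → All (Below n) p → ColStrict (p ++ topPart n a b) (topPart n a' b') →
                 a' ≤ length p × a' + b' ≤ length p + a
colStrict-top⇒ n p a b zero b' lp cs =
  z≤n , subst (b' ≤_) (length-++tops n p a)
          (colStrict-bars⇒ n (p ++ replicate a (top n)) b b' (<topBar-++tops n p a lp)
             (subst (λ X → ColStrict X (replicate b' (topBar n))) (sym (++-assoc p (replicate a (top n)) _)) cs))
colStrict-top⇒ n (_ ∷ p) a b (suc a') b' (_ ∷ lp) (_ , cs) with colStrict-top⇒ n p a b a' b' lp cs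
... | l₁ , l₂ = s≤s l₁ , s≤s l₂
colStrict-top⇒ n [] zero    zero    (suc a') b' _ ()
colStrict-top⇒ n [] (suc a) b       (suc a') b' _ (lt , _) = ⊥-elim (<-irrefl refl lt)
colStrict-top⇒ n [] zero    (suc b) (suc a') b' _ (lt , _) = ⊥-elim (<-irrefl refl (<⇒≤ lt))

colStrict-top⇐ : ∀ n p a b a' b' → All (Below n) p → a' ≤ length p → a' + b' ≤ length p + a →
                 ColStrict (p ++ topPart n a b) (topPart n a' b')
colStrict-top⇐ n p a b zero b' lp _ le =
  subst (λ X → ColStrict X (replicate b' (topBar n))) (++-assoc p (replicate a (top n)) _)
    (colStrict-bars⇐ n (p ++ replicate a (top n)) b b' (<topBar-++tops n p a lp)
       (subst (b' ≤_) (sym (length-++tops n p a)) le))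
colStrict-top⇐ n (x ∷ p) a b (suc a') b' (lx ∷ lp) (s≤s l₁) (s≤s l₂) =
  below<top {n} {x} lx , colStrict-top⇐ n p a b a' b' lp l₁ l₂

-- ColStrict (p ++ topPart n a b) (p' ++ topPart n a' b') in terms of the parts
LayerColStrict : List Letter → ℕ → ℕ → List Letter → ℕ → ℕ → Set
LayerColStrict p a b p' a' b' =
  ColStrict p p' × length p' + a' ≤ length p × length p' + a' + b' ≤ length p + a

colStrict-layer⇒ : ∀ n p a b p' a' b' → All (Below n) p → All (Below n) p' →
                   ColStrict (p ++ topPart n a b) (p' ++ topPart n a' b') → LayerColStrict p a b p' a' b'
colStrict-layer⇒ n p a b [] a' b' lp _ cs with colStrict-top⇒ n p a b a' b' lp cs
... | l₁ , l₂ = tt , l₁ , l₂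
colStrict-layer⇒ n (_ ∷ p) a b (_ ∷ p') a' b' (_ ∷ lp) (_ ∷ lp') (lt , cs)
  with colStrict-layer⇒ n p a b p' a' b' lp lp' cs
... | c , l₁ , l₂ = (lt , c) , s≤s l₁ , s≤s l₂
colStrict-layer⇒ n [] zero    zero    (_ ∷ _) _ _ _ _        ()
colStrict-layer⇒ n [] (suc a) b       (y ∷ _) _ _ _ (ly ∷ _) (lt , _) =
  ⊥-elim (top≰below {n} {y} ly (<⇒≤ lt))
colStrict-layer⇒ n [] zero    (suc b) (y ∷ _) _ _ _ (ly ∷ _) (lt , _) =
  ⊥-elim (top≰below {n} {y} ly (≤-trans (n≤1+n _) (<⇒≤ lt)))

colStrict-layer⇐ : ∀ n p a b p' a' b' → All (Below n) p → All (Below n) p' →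
                   LayerColStrict p a b p' a' b' → ColStrict (p ++ topPart n a b) (p' ++ topPart n a' b')
colStrict-layer⇐ n p a b [] a' b' lp _ (_ , l₁ , l₂) = colStrict-top⇐ n p a b a' b' lp l₁ l₂
colStrict-layer⇐ n (_ ∷ p) a b (_ ∷ p') a' b' (_ ∷ lp) (_ ∷ lp') ((lt , c) , s≤s l₁ , s≤s l₂) =
  lt , colStrict-layer⇐ n p a b p' a' b' lp lp' (c , l₁ , l₂)
colStrict-layer⇐ n [] _ _ (_ ∷ _) _ _ _ _ (_ , () , _)

below? : ∀ n (e : Letter) → Dec (Below n e)
below? n e = idx e ≤? n

lower : ℕ → List Letter → List Letter
lower n = filter (below? n)

#top #topBar : ℕ → List Letter → ℕ
#top    n = countLetter (suc n) false
#topBar n = countLetter (suc n) true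

middle : ℕ → List Letter → ℕ
middle n r = length (lower n r) + #top n r

lower-split : ∀ n p a b → All (Below n) p → lower n (p ++ topPart n a b) ≡ p
lower-split n p a b lp = begin
  lower n (p ++ topPart n a b)            ≡⟨ filter-++ (below? n) p (topPart n a b) ⟩
  lower n p ++ lower n (topPart n a b)    ≡⟨ cong₂ _++_ (filter-all (below? n) lp) (filter-none (below? n) topsNotBelow) ⟩
  p ++ []                                 ≡⟨ ++-identityʳ p ⟩
  p                                       ∎
  where
  open ≡-Reasoning
  topsNotBelow : All (λ e → ¬ Below n e) (topPart n a b)
  topsNotBelow = All.++⁺ (All.replicate⁺ a (1+n≰n {n})) (All.replicate⁺ b (1+n≰n {n}))

-- Defs' letter comparison lives in a where block depending on the whole list,
-- so a single letter has to be split off by cases.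
countLetter-∷ : ∀ i c j d xs →
                countLetter i c (letter j d ∷ xs) ≡ countLetter i c (letter j d ∷ []) + countLetter i c xs
countLetter-∷ i false j false xs with i ≡ᵇ j
... | true  = refl
... | false = refl
countLetter-∷ i false j true  xs with i ≡ᵇ j
... | true  = refl
... | false = refl
countLetter-∷ i true  j false xs with i ≡ᵇ j
... | true  = refl
... | false = refl
countLetter-∷ i true  j true  xs with i ≡ᵇ j
... | true  = refl
... | false = refl

countLetter-++ : ∀ i c xs ys → countLetter i c (xs ++ ys) ≡ countLetter i c xs + countLetter i c ys
countLetter-++ i c []                ys = refl
countLetter-++ i c (letter j d ∷ xs) ys = begin
  countLetter i c (letter j d ∷ xs ++ ys)                         ≡⟨ countLetter-∷ i c j d (xs ++ ys) ⟩
  count₁ + countLetter i c (xs ++ ys)                             ≡⟨ cong (count₁ +_) (countLetter-++ i c xs ys) ⟩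
  count₁ + (countLetter i c xs + countLetter i c ys)              ≡⟨ +-assoc count₁ _ _ ⟨
  count₁ + countLetter i c xs + countLetter i c ys                ≡⟨ cong (_+ countLetter i c ys) (countLetter-∷ i c j d xs) ⟨
  countLetter i c (letter j d ∷ xs) + countLetter i c ys          ∎
  where
  open ≡-Reasoning
  count₁ = countLetter i c (letter j d ∷ [])

≡ᵇ-refl : ∀ n → (n ≡ᵇ n) ≡ true
≡ᵇ-refl zero    = refl
≡ᵇ-refl (suc n) = ≡ᵇ-refl n

≢⇒≡ᵇ-false : ∀ {m n} → m ≢ n → (m ≡ᵇ n) ≡ false
≢⇒≡ᵇ-false {m} {n} m≢n with m ≡ᵇ n in eq
... | false = refl
... | true  = ⊥-elim (m≢n (≡ᵇ⇒≡ m n (subst T (sym eq) tt)))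

countTop-below : ∀ n c p → All (Below n) p → countLetter (suc n) c p ≡ 0
countTop-below n c []               _         = refl
countTop-below n c (letter j _ ∷ p) (le ∷ lp)
  rewrite ≢⇒≡ᵇ-false (>⇒≢ (s≤s le)) = countTop-below n c p lp

#top-tops : ∀ n a → #top n (replicate a (top n)) ≡ a
#top-tops n zero    = refl
#top-tops n (suc a) rewrite ≡ᵇ-refl n = cong suc (#top-tops n a)

#top-topBars : ∀ n b → #top n (replicate b (topBar n)) ≡ 0
#top-topBars n zero    = refl
#top-topBars n (suc b) rewrite ≡ᵇ-refl n = #top-topBars n b

#topBar-tops : ∀ n a → #topBar n (replicate a (top n)) ≡ 0
#topBar-tops n zero    = refl
#topBar-tops n (suc a) rewrite ≡ᵇ-refl n = #topBar-tops n a

#topBar-topBars : ∀ n b → #topBar n (replicate b (topBar n)) ≡ b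
#topBar-topBars n zero    = refl
#topBar-topBars n (suc b) rewrite ≡ᵇ-refl n = cong suc (#topBar-topBars n b)

#top-split : ∀ n p a b → All (Below n) p → #top n (p ++ topPart n a b) ≡ a
#top-split n p a b lp
  rewrite countLetter-++ (suc n) false p (topPart n a b) | countTop-below n false p lp
        | countLetter-++ (suc n) false (replicate a (top n)) (replicate b (topBar n))
        | #top-tops n a | #top-topBars n b = +-identityʳ a

#topBar-split : ∀ n p a b → All (Below n) p → #topBar n (p ++ topPart n a b) ≡ b
#topBar-split n p a b lp
  rewrite countLetter-++ (suc n) true p (topPart n a b) | countTop-below n true p lp
        | countLetter-++ (suc n) true (replicate a (top n)) (replicate b (topBar n))
        | #topBar-tops n a | #topBar-topBars n b = refl

countLetter-topPart : ∀ n k c a b → k ≤ n → countLetter k c (topPart n a b) ≡ 0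
countLetter-topPart n k c a b le
  rewrite countLetter-++ k c (replicate a (top n)) (replicate b (topBar n)) =
  cong₂ _+_ (none a false) (none b true)
  where
  none : ∀ m d → countLetter k c (replicate m (letter (suc n) d)) ≡ 0
  none zero    d = refl
  none (suc m) d rewrite ≢⇒≡ᵇ-false (<⇒≢ (s≤s le)) = none m d

row-lower-split : ∀ n r → Linked _≤L_ r → All (λ e → idx e ≤ suc n) r →
            r ≡ lower n r ++ topPart n (#top n r) (#topBar n r) × All (Below n) (lower n r)
row-lower-split n r s ir with rowSplit n r s ir
... | p , a , b , refl , lp
  rewrite lower-split n p a b lp | #top-split n p a b lp | #topBar-split n p a b lp = refl , lp

Rows : Set
Rows = List (List Letter)

shape : Rows → List ℕ
shape = map length

attachTop : ℕ → Rows → List ℕ → List ℕ → Rows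
attachTop n (p ∷ P) (a ∷ as) (b ∷ bs) = (p ++ topPart n a b) ∷ attachTop n P as bs
attachTop n _       _        _        = []

-- λ and μ of an attached tableau: the shapes of its letters ≤ n + 1 and of all its letters
middleShape : Rows → List ℕ → List ℕ
middleShape (p ∷ P) (a ∷ as) = length p + a ∷ middleShape P as
middleShape _       _        = []

outerShape : Rows → List ℕ → List ℕ → List ℕ
outerShape (p ∷ P) (a ∷ as) (b ∷ bs) = length p + a + b ∷ outerShape P as bs
outerShape _       _        _        = []

record SameLengths (P : Rows) (as bs : List ℕ) : Set where
  constructor sameLengths
  field
    as-length : length as ≡ length P
    bs-length : length bs ≡ length P

SameLengths-tail : ∀ {p P a as b bs} → SameLengths (p ∷ P) (a ∷ as) (b ∷ bs) → SameLengths P as bs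
SameLengths-tail (sameLengths e₁ e₂) = sameLengths (suc-injective e₁) (suc-injective e₂)

attachTop-colsStrict⇒ : ∀ n P as bs → All (All (Below n)) P → SameLengths P as bs →
                        ColsStrict (attachTop n P as bs) →
                        ColsStrict P × shape P ≺ middleShape P as × middleShape P as ≺ outerShape P as bs
attachTop-colsStrict⇒ n [] [] [] _ _ _ = tt , tt , tt
attachTop-colsStrict⇒ n (p ∷ []) (a ∷ []) (b ∷ []) _ _ _ = tt , (m≤m+n _ a , z≤n , tt) , (m≤m+n _ b , z≤n , tt)
attachTop-colsStrict⇒ n (p ∷ p' ∷ P) (a ∷ a' ∷ as) (b ∷ b' ∷ bs) (lp ∷ lP) ls (cs , css)
  with colStrict-layer⇒ n p a b p' a' b' lp (All.head lP) cs
     | attachTop-colsStrict⇒ n (p' ∷ P) (a' ∷ as) (b' ∷ bs) lP (SameLengths-tail ls) css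
... | c , l₁ , l₂ | cP , il₁ , il₂ = (c , cP) , (m≤m+n _ a , l₁ , il₁) , (m≤m+n _ b , l₂ , il₂)
attachTop-colsStrict⇒ n (_ ∷ []) (_ ∷ []) (_ ∷ _ ∷ _) _ (sameLengths _ ()) _
attachTop-colsStrict⇒ n (_ ∷ _ ∷ _) (_ ∷ _ ∷ _) (_ ∷ []) _ (sameLengths _ ()) _

attachTop-colsStrict⇐ : ∀ n P as bs → All (All (Below n)) P → SameLengths P as bs → ColsStrict P →
                        shape P ≺ middleShape P as → middleShape P as ≺ outerShape P as bs →
                        ColsStrict (attachTop n P as bs)
attachTop-colsStrict⇐ n [] [] [] _ _ _ _ _ = tt
attachTop-colsStrict⇐ n (p ∷ []) (a ∷ []) (b ∷ []) _ _ _ _ _ = tt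
attachTop-colsStrict⇐ n (p ∷ p' ∷ P) (a ∷ a' ∷ as) (b ∷ b' ∷ bs) (lp ∷ lP) ls (c , cP)
                      (_ , l₁ , il₁) (_ , l₂ , il₂) =
  colStrict-layer⇐ n p a b p' a' b' lp (All.head lP) (c , l₁ , l₂) ,
  attachTop-colsStrict⇐ n (p' ∷ P) (a' ∷ as) (b' ∷ bs) lP (SameLengths-tail ls) cP il₁ il₂
attachTop-colsStrict⇐ n (_ ∷ []) (_ ∷ []) (_ ∷ _ ∷ _) _ (sameLengths _ ()) _ _ _
attachTop-colsStrict⇐ n (_ ∷ _ ∷ _) (_ ∷ _ ∷ _) (_ ∷ []) _ (sameLengths _ ()) _ _ _

linked-++ : ∀ {xs ys} → Linked _≤L_ xs → Linked _≤L_ ys → All (λ x → FirstAtLeast x ys) xs →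
            Linked _≤L_ (xs ++ ys)
linked-++ {[]}              _         l _        = l
linked-++ {_ ∷ []} {[]}     _         _ _        = [-]
linked-++ {_ ∷ []} {_ ∷ _}  _         l (h ∷ _)  = h ∷ l
linked-++ {_ ∷ _ ∷ _}       (le ∷ lx) l (_ ∷ hs) = le ∷ linked-++ lx l hs

linked-replicate : ∀ k (e : Letter) → Linked _≤L_ (replicate k e)
linked-replicate zero          e = []
linked-replicate (suc zero)    e = [-]
linked-replicate (suc (suc k)) e = ≤-refl ∷ linked-replicate (suc k) e

linked-topPart : ∀ n a b → Linked _≤L_ (topPart n a b)
linked-topPart n a b =
  linked-++ (linked-replicate a (top n)) (linked-replicate b (topBar n)) (All.replicate⁺ a (top≤bars b))
  where
  top≤bars : ∀ b → FirstAtLeast (top n) (replicate b (topBar n))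
  top≤bars zero    = tt
  top≤bars (suc _) = n≤1+n _

below-FirstAtLeast-topPart : ∀ n a b e → Below n e → FirstAtLeast e (topPart n a b)
below-FirstAtLeast-topPart n (suc a) b       e le = <⇒≤ (below<top {n} {e} le)
below-FirstAtLeast-topPart n zero    (suc b) e le = <⇒≤ (below<topBar {n} {e} le)
below-FirstAtLeast-topPart n zero    zero    e le = tt

linked-attach : ∀ n p a b → All (Below n) p → Linked _≤L_ p → Linked _≤L_ (p ++ topPart n a b)
linked-attach n p a b lp s = linked-++ s (linked-topPart n a b) (All.map (below-FirstAtLeast-topPart n a b _) lp)

inAlphabet-attach : ∀ n p a b → All (InAlphabet n) p → All (InAlphabet (suc n)) (p ++ topPart n a b)
inAlphabet-attach n p a b ia =
  All.++⁺ (All.map (λ { (i₁ , i₂) → i₁ , ≤-trans i₂ (n≤1+n _) }) ia)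
          (All.++⁺ (All.replicate⁺ a (s≤s z≤n , ≤-refl)) (All.replicate⁺ b (s≤s z≤n , ≤-refl)))

attachTop-rowsBounded⇒ : ∀ n i P as bs → SameLengths P as bs →
                         RowsBounded i (attachTop n P as bs) → RowsBounded i P
attachTop-rowsBounded⇒ n i [] _ _ _ _ = tt
attachTop-rowsBounded⇒ n i (p ∷ P) (_ ∷ as) (_ ∷ bs) ls (r , rs) =
  All.++⁻ˡ p r , attachTop-rowsBounded⇒ n (suc i) P as bs (SameLengths-tail ls) rs

topPart-bounded : ∀ n i a b → i ≤ suc n → All (λ x → letter i false ≤L x) (topPart n a b)
topPart-bounded n i a b le =
  All.++⁺ (All.replicate⁺ a (*-monoʳ-≤ 2 le)) (All.replicate⁺ b (≤-trans (*-monoʳ-≤ 2 le) (n≤1+n _)))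

attachTop-rowsBounded⇐ : ∀ n i P as bs → i + length P ≤ suc (suc n) → RowsBounded i P →
                         RowsBounded i (attachTop n P as bs)
attachTop-rowsBounded⇐ n i []      _        _        _  _        = tt
attachTop-rowsBounded⇐ n i (_ ∷ _) []       _        _  _        = tt
attachTop-rowsBounded⇐ n i (_ ∷ _) (_ ∷ _)  []       _  _        = tt
attachTop-rowsBounded⇐ n i (p ∷ P) (a ∷ as) (b ∷ bs) le (r , rs) =
  All.++⁺ r (topPart-bounded n i a b (m+n≤o⇒m≤o i (≤-pred le'))) ,
  attachTop-rowsBounded⇐ n (suc i) P as bs le' rs
  where
  le' : suc i + length P ≤ suc (suc n)
  le' = subst (_≤ suc (suc n)) (+-suc i (length P)) le

lower-attachTop : ∀ n P as bs → All (All (Below n)) P → SameLengths P as bs →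
                  map (lower n) (attachTop n P as bs) ≡ P
lower-attachTop n [] [] [] _ _ = refl
lower-attachTop n (p ∷ P) (a ∷ as) (b ∷ bs) (lp ∷ lP) ls =
  cong₂ _∷_ (lower-split n p a b lp) (lower-attachTop n P as bs lP (SameLengths-tail ls))

middle-attachTop : ∀ n P as bs → All (All (Below n)) P → SameLengths P as bs →
                   map (middle n) (attachTop n P as bs) ≡ middleShape P as
middle-attachTop n [] [] [] _ _ = refl
middle-attachTop n (p ∷ P) (a ∷ as) (b ∷ bs) (lp ∷ lP) ls =
  cong₂ _∷_ (cong₂ _+_ (cong length (lower-split n p a b lp)) (#top-split n p a b lp))
            (middle-attachTop n P as bs lP (SameLengths-tail ls))

length-attach : ∀ n (p : List Letter) a b → length (p ++ topPart n a b) ≡ length p + a + b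
length-attach n p a b = begin
  length (p ++ topPart n a b)                                     ≡⟨ length-++ p ⟩
  length p + length (replicate a (top n) ++ replicate b (topBar n)) ≡⟨ cong (length p +_) (length-++ (replicate a (top n))) ⟩
  length p + (length (replicate a (top n)) + length (replicate b (topBar n)))
    ≡⟨ cong (length p +_) (cong₂ _+_ (length-replicate a) (length-replicate b)) ⟩
  length p + (a + b)                                              ≡⟨ +-assoc (length p) a b ⟨
  length p + a + b                                                ∎
  where open ≡-Reasoning

shape-attachTop : ∀ n P as bs → shape (attachTop n P as bs) ≡ outerShape P as bs
shape-attachTop n (p ∷ P) (a ∷ as) (b ∷ bs) = cong₂ _∷_ (length-attach n p a b) (shape-attachTop n P as bs)
shape-attachTop n []      _        _        = refl
shape-attachTop n (_ ∷ _) []       _        = refl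
shape-attachTop n (_ ∷ _) (_ ∷ _)  []       = refl

length-attachTop : ∀ n P as bs → SameLengths P as bs → length (attachTop n P as bs) ≡ length P
length-attachTop n [] [] [] _ = refl
length-attachTop n (_ ∷ P) (_ ∷ as) (_ ∷ bs) ls = cong suc (length-attachTop n P as bs (SameLengths-tail ls))

All-attachTop : ∀ n {Q Q' : List Letter → Set} → (∀ p a b → Q p → Q' (p ++ topPart n a b)) →
                ∀ P as bs → All Q P → All Q' (attachTop n P as bs)
All-attachTop n f (p ∷ P) (a ∷ as) (b ∷ bs) (q ∷ qs) = f p a b q ∷ All-attachTop n f P as bs qs
All-attachTop n f []      _        _        _        = []
All-attachTop n f (_ ∷ _) []       _        _        = []
All-attachTop n f (_ ∷ _) (_ ∷ _)  []       _        = []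

rows-split : ∀ n R → All (Linked _≤L_) R → All (All (λ e → idx e ≤ suc n)) R →
             R ≡ attachTop n (map (lower n) R) (map (#top n) R) (map (#topBar n) R)
             × All (All (Below n)) (map (lower n) R)
rows-split n []      _        _          = refl , []
rows-split n (r ∷ R) (s ∷ ss) (ir ∷ irs) with row-lower-split n r s ir | rows-split n R ss irs
... | e , lp | e' , lP = cong₂ _∷_ e e' , lp ∷ lP

SameLengths-split : ∀ n R → SameLengths (map (lower n) R) (map (#top n) R) (map (#topBar n) R)
SameLengths-split n R = sameLengths (trans (length-map _ R) (sym (length-map _ R)))
                                    (trans (length-map _ R) (sym (length-map _ R)))

topCounts : Rows → List ℕ → List ℕ
topCounts (p ∷ P) (l ∷ ls) = (l ∸ length p) ∷ topCounts P ls
topCounts _       _        = []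

barCounts : List ℕ → List ℕ → List ℕ
barCounts (l ∷ ls) (u ∷ us) = (u ∸ l) ∷ barCounts ls us
barCounts _        _        = []

middleShape-topCounts : ∀ P ls → shape P ≺ ls → middleShape P (topCounts P ls) ≡ ls
middleShape-topCounts []      []       _             = refl
middleShape-topCounts (p ∷ P) (l ∷ ls) (le , _ , il) = cong₂ _∷_ (m+[n∸m]≡n le) (middleShape-topCounts P ls il)

outerShape-barCounts : ∀ P ls us → shape P ≺ ls → ls ≺ us → outerShape P (topCounts P ls) (barCounts ls us) ≡ us
outerShape-barCounts []      []       []       _             _ = refl
outerShape-barCounts (p ∷ P) (l ∷ ls) (u ∷ us) (le , _ , il) (le' , _ , il') =
  cong₂ _∷_ (trans (cong (_+ (u ∸ l)) (m+[n∸m]≡n le)) (m+[n∸m]≡n le')) (outerShape-barCounts P ls us il il')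

SameLengths-counts : ∀ P ls us → shape P ≺ ls → ls ≺ us → SameLengths P (topCounts P ls) (barCounts ls us)
SameLengths-counts []      []       []       _            _             = sameLengths refl refl
SameLengths-counts (_ ∷ P) (_ ∷ ls) (_ ∷ us) (_ , _ , il) (_ , _ , il') with SameLengths-counts P ls us il il'
... | sameLengths e₁ e₂ = sameLengths (cong suc e₁) (cong suc e₂)

topCounts-middleShape : ∀ P as bs → SameLengths P as bs → topCounts P (middleShape P as) ≡ as
topCounts-middleShape [] [] [] _ = refl
topCounts-middleShape (p ∷ P) (a ∷ as) (b ∷ bs) ls =
  cong₂ _∷_ (m+n∸m≡n (length p) a) (topCounts-middleShape P as bs (SameLengths-tail ls))

barCounts-outerShape : ∀ P as bs → SameLengths P as bs → barCounts (middleShape P as) (outerShape P as bs) ≡ bs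
barCounts-outerShape [] [] [] _ = refl
barCounts-outerShape (p ∷ P) (a ∷ as) (b ∷ bs) ls =
  cong₂ _∷_ (m+n∸m≡n (length p + a) b) (barCounts-outerShape P as bs (SameLengths-tail ls))

-- King tableaux padded with empty rows to exactly n rows

record PaddedKing (n : ℕ) (R : Rows) : Set where
  constructor paddedKing
  field
    rows-length : length R ≡ n
    alphabet    : All (All (InAlphabet n)) R
    rowsWeak    : All (Linked _≤L_) R
    colsStrict  : ColsStrict R
    rowsBounded : RowsBounded 1 R

dropLast : ∀ {X : Set} → List X → List X
dropLast []           = []
dropLast (_ ∷ [])     = []
dropLast (x ∷ y ∷ ys) = x ∷ dropLast (y ∷ ys)

dropLast-∷ʳ : ∀ {X : Set} (xs : List X) y → dropLast (xs ∷ʳ y) ≡ xs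
dropLast-∷ʳ []           _ = refl
dropLast-∷ʳ (_ ∷ [])     _ = refl
dropLast-∷ʳ (x ∷ x' ∷ xs) y = cong (x ∷_) (dropLast-∷ʳ (x' ∷ xs) y)

All-dropLast : ∀ {X : Set} {Q : X → Set} {xs} → All Q xs → All Q (dropLast xs)
All-dropLast []           = []
All-dropLast (_ ∷ [])     = []
All-dropLast (q ∷ q' ∷ qs) = q ∷ All-dropLast (q' ∷ qs)

ColsStrict-dropLast : ∀ R → ColsStrict R → ColsStrict (dropLast R)
ColsStrict-dropLast []              _        = tt
ColsStrict-dropLast (_ ∷ [])        _        = tt
ColsStrict-dropLast (_ ∷ _ ∷ [])    _        = tt
ColsStrict-dropLast (_ ∷ y ∷ z ∷ R) (c , cs) = c , ColsStrict-dropLast (y ∷ z ∷ R) cs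

RowsBounded-dropLast : ∀ i R → RowsBounded i R → RowsBounded i (dropLast R)
RowsBounded-dropLast i []          _        = tt
RowsBounded-dropLast i (_ ∷ [])    _        = tt
RowsBounded-dropLast i (_ ∷ y ∷ R) (r , rs) = r , RowsBounded-dropLast (suc i) (y ∷ R) rs

length-dropLast : ∀ {X : Set} (xs : List X) → length (dropLast xs) ≡ length xs ∸ 1
length-dropLast []          = refl
length-dropLast (_ ∷ [])    = refl
length-dropLast (_ ∷ y ∷ xs) = cong suc (length-dropLast (y ∷ xs))

length-∷ʳ : ∀ {X : Set} (xs : List X) y → length (xs ∷ʳ y) ≡ suc (length xs)
length-∷ʳ xs y = trans (length-++ xs) (+-comm (length xs) 1)

ColsStrict-∷ʳ[] : ∀ R → ColsStrict R → ColsStrict (R ∷ʳ [])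
ColsStrict-∷ʳ[] []          _        = tt
ColsStrict-∷ʳ[] (_ ∷ [])    _        = tt , tt
ColsStrict-∷ʳ[] (_ ∷ y ∷ R) (c , cs) = c , ColsStrict-∷ʳ[] (y ∷ R) cs

RowsBounded-∷ʳ[] : ∀ i R → RowsBounded i R → RowsBounded i (R ∷ʳ [])
RowsBounded-∷ʳ[] i []      _        = [] , tt
RowsBounded-∷ʳ[] i (_ ∷ R) (r , rs) = r , RowsBounded-∷ʳ[] (suc i) R rs

shape-∷ʳ[] : ∀ P → shape (P ∷ʳ []) ≡ shape P ∷ʳ 0
shape-∷ʳ[] P = map-++ length P ([] ∷ [])

-- In row n + 1 every letter is at least n + 1, so no letter below n + 1 is left there.
lastRow-lower-empty : ∀ n i P as bs → SameLengths P as bs → All (All (Below n)) P →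
                      RowsBounded i (attachTop n P as bs) → i + length P ≡ suc (suc n) → 1 ≤ length P →
                      P ≡ dropLast P ∷ʳ []
lastRow-lower-empty n i (p ∷ []) (_ ∷ _) (_ ∷ _) _ (lp ∷ _) (r , _) e _ with p | lp | r
... | []    | _      | _      = refl
... | x ∷ _ | lx ∷ _ | rx ∷ _ =
  ⊥-elim (top≰below {n} {x} lx (subst (λ k → letter k false ≤L x) (suc-injective (trans (+-comm 1 i) e)) rx))
lastRow-lower-empty n i (p ∷ p' ∷ P) (_ ∷ as) (_ ∷ bs) ls (_ ∷ lP) (_ , rs) e _ =
  cong (p ∷_) (lastRow-lower-empty n (suc i) (p' ∷ P) as bs (SameLengths-tail ls) lP rs
                                   (trans (sym (+-suc i _)) e) (s≤s z≤n))

-- a padded King tableau with n + 1 rows as one with n rows plus the letters n + 1 and n + 1 bar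
record TopLayer (n : ℕ) (R : Rows) : Set where
  field
    split        : R ≡ attachTop n (map (lower n) R) (map (#top n) R) (map (#topBar n) R)
    lastEmpty    : map (lower n) R ≡ dropLast (map (lower n) R) ∷ʳ []
    restKing     : PaddedKing n (dropLast (map (lower n) R))
    inner≺middle : shape (map (lower n) R) ≺ map (middle n) R
    middle≺outer : map (middle n) R ≺ shape R
    lowerBelow   : All (All (Below n)) (map (lower n) R)

  middle-attachTop-split : map (middle n) R ≡ middleShape (map (lower n) R) (map (#top n) R)
  middle-attachTop-split =
    trans (cong (map (middle n)) split) (middle-attachTop n _ _ _ lowerBelow (SameLengths-split n R))

  shape-attachTop-split : shape R ≡ outerShape (map (lower n) R) (map (#top n) R) (map (#topBar n) R)
  shape-attachTop-split = trans (cong shape split) (shape-attachTop n _ _ _)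

lower-king : ∀ n r → Linked _≤L_ r → All (InAlphabet (suc n)) r →
             All (InAlphabet n) (lower n r) × Linked _≤L_ (lower n r)
lower-king n r s ia with row-lower-split n r s (All.map proj₂ ia)
... | e , lp =
  All.zipWith (λ { ((i₁ , _) , lo) → i₁ , lo }) (All.++⁻ˡ (lower n r) (subst (All (InAlphabet (suc n))) e ia) , lp) ,
  linked-prefix (lower n r) (subst (Linked _≤L_) e s)
  where
  linked-prefix : ∀ (xs : List Letter) {ys} → Linked _≤L_ (xs ++ ys) → Linked _≤L_ xs
  linked-prefix []           _        = []
  linked-prefix (_ ∷ [])     _        = [-]
  linked-prefix (_ ∷ y ∷ xs) (le ∷ l) = le ∷ linked-prefix (y ∷ xs) l

peelTop : ∀ n R → PaddedKing (suc n) R → TopLayer n R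
peelTop n R (paddedKing lenR alph weak cols bounded) = record
  { split        = split
  ; lastEmpty    = lastEmpty
  ; restKing     = paddedKing (trans (length-dropLast P) (cong (_∸ 1) lenP))
                              (All-dropLast (All.map proj₁ lowerKing)) (All-dropLast (All.map proj₂ lowerKing))
                              (ColsStrict-dropLast P (proj₁ layers))
                              (RowsBounded-dropLast 1 P (attachTop-rowsBounded⇒ n 1 P _ _ ls boundedAttached))
  ; inner≺middle = subst (shape P ≺_) (sym middleEq) (proj₁ (proj₂ layers))
  ; middle≺outer = subst₂ _≺_ (sym middleEq) (sym outerEq) (proj₂ (proj₂ layers))
  ; lowerBelow   = lowerBelow }
  where
  P = map (lower n) R
  splitAll = rows-split n R weak (All.map (All.map proj₂) alph)
  split = proj₁ splitAll
  lowerBelow = proj₂ splitAll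
  ls = SameLengths-split n R
  layers = attachTop-colsStrict⇒ n P _ _ lowerBelow ls (subst ColsStrict split cols)
  middleEq : map (middle n) R ≡ middleShape P (map (#top n) R)
  middleEq = trans (cong (map (middle n)) split) (middle-attachTop n P _ _ lowerBelow ls)
  outerEq : shape R ≡ outerShape P (map (#top n) R) (map (#topBar n) R)
  outerEq = trans (cong shape split) (shape-attachTop n P _ _)
  lenP : length P ≡ suc n
  lenP = trans (length-map _ R) lenR
  boundedAttached = subst (RowsBounded 1) split bounded
  lastEmpty = lastRow-lower-empty n 1 P _ _ ls lowerBelow boundedAttached (cong suc lenP)
                                  (subst (1 ≤_) (sym lenP) (s≤s z≤n))
  lowerKing = All.map⁺ (All.zipWith (λ { (s , ia) → lower-king n _ s ia }) (weak , alph))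

-- Conversely, a padded tableau with n rows and shapes κ ≺ λ ≺ μ (κ with a zero appended)
-- extends to one with n + 1 rows.
module _ (n : ℕ) (P : Rows) (lm mu : List ℕ) where

  extension : Rows
  extension = attachTop n (P ∷ʳ []) (topCounts (P ∷ʳ []) lm) (barCounts lm mu)

  record Extension : Set where
    field
      king         : PaddedKing (suc n) extension
      shape-ext    : shape extension ≡ mu
      middle-ext   : map (middle n) extension ≡ lm
      lower-ext    : map (lower n) extension ≡ P ∷ʳ []

  extend : PaddedKing n P → shape P ∷ʳ 0 ≺ lm → lm ≺ mu → Extension
  extend (paddedKing lenP alph weak cols bounded) il₁ il₂ = record
    { king       = paddedKing (trans (length-attachTop n P' as bs ls) lenP')
                              (All-attachTop n (λ p a b → inAlphabet-attach n p a b) P' as bs (All.∷ʳ⁺ alph []))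
                              (All-attachTop n (λ p a b q → linked-attach n p a b (proj₁ q) (proj₂ q)) P' as bs
                                             (All.zip (lowerBelow , All.∷ʳ⁺ weak [])))
                              (attachTop-colsStrict⇐ n P' as bs lowerBelow ls (ColsStrict-∷ʳ[] P cols)
                                                     (subst (shape P' ≺_) (sym middleE) il₁')
                                                     (subst₂ _≺_ (sym middleE) (sym outerE) il₂))
                              (attachTop-rowsBounded⇐ n 1 P' as bs (≤-reflexive (cong suc lenP'))
                                                      (RowsBounded-∷ʳ[] 1 P bounded))
    ; shape-ext  = trans (shape-attachTop n P' as bs) outerE
    ; middle-ext = trans (middle-attachTop n P' as bs lowerBelow ls) middleE
    ; lower-ext  = lower-attachTop n P' as bs lowerBelow ls }
    where
    P' = P ∷ʳ []
    as = topCounts P' lm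
    bs = barCounts lm mu
    il₁' : shape P' ≺ lm
    il₁' = subst (_≺ lm) (sym (shape-∷ʳ[] P)) il₁
    ls = SameLengths-counts P' lm mu il₁' il₂
    lowerBelow : All (All (Below n)) P'
    lowerBelow = All.∷ʳ⁺ (All.map (All.map proj₂) alph) []
    middleE : middleShape P' as ≡ lm
    middleE = middleShape-topCounts P' lm il₁'
    outerE : outerShape P' as bs ≡ mu
    outerE = outerShape-barCounts P' lm mu il₁' il₂
    lenP' : length P' ≡ suc n
    lenP' = trans (length-∷ʳ P []) (cong suc lenP)

lowerRows : ℕ → Rows → Rows
lowerRows n R = dropLast (map (lower n) R)

extension-peelTop : ∀ n R → (t : TopLayer n R) →
                    extension n (lowerRows n R) (map (middle n) R) (shape R) ≡ R
extension-peelTop n R t = begin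
  attachTop n (P ∷ʳ []) (topCounts (P ∷ʳ []) (map (middle n) R)) (barCounts (map (middle n) R) (shape R))
    ≡⟨ cong (λ X → attachTop n X (topCounts X (map (middle n) R)) (barCounts (map (middle n) R) (shape R)))
            (sym lastEmpty) ⟩
  attachTop n P' (topCounts P' (map (middle n) R)) (barCounts (map (middle n) R) (shape R))
    ≡⟨ cong₂ (λ l u → attachTop n P' (topCounts P' l) (barCounts l u)) middle-attachTop-split shape-attachTop-split ⟩
  attachTop n P' (topCounts P' (middleShape P' as)) (barCounts (middleShape P' as) (outerShape P' as bs))
    ≡⟨ cong₂ (attachTop n P') (topCounts-middleShape P' as bs ls) (barCounts-outerShape P' as bs ls) ⟩
  attachTop n P' as bs
    ≡⟨ split ⟨
  R ∎
  where
  open ≡-Reasoning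
  open TopLayer t
  P = lowerRows n R
  P' = map (lower n) R
  as = map (#top n) R
  bs = map (#topBar n) R
  ls = SameLengths-split n R

countLetter-concat : ∀ i c R → countLetter i c (concat R) ≡ sum (map (countLetter i c) R)
countLetter-concat i c []      = refl
countLetter-concat i c (r ∷ R) = trans (countLetter-++ i c r (concat R)) (cong (countLetter i c r +_) (countLetter-concat i c R))

countLetter-attachTop : ∀ n j c P as bs → SameLengths P as bs → j ≤ n →
                        countLetter j c (concat (attachTop n P as bs)) ≡ countLetter j c (concat P)
countLetter-attachTop n j c [] [] [] _ _ = refl
countLetter-attachTop n j c (p ∷ P) (a ∷ as) (b ∷ bs) ls le = begin
  countLetter j c ((p ++ topPart n a b) ++ concat (attachTop n P as bs))
    ≡⟨ countLetter-++ j c (p ++ topPart n a b) _ ⟩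
  countLetter j c (p ++ topPart n a b) + countLetter j c (concat (attachTop n P as bs))
    ≡⟨ cong₂ _+_ (trans (countLetter-++ j c p (topPart n a b))
                        (trans (cong (countLetter j c p +_) (countLetter-topPart n j c a b le)) (+-identityʳ _)))
                 (countLetter-attachTop n j c P as bs (SameLengths-tail ls) le) ⟩
  countLetter j c p + countLetter j c (concat P)
    ≡⟨ countLetter-++ j c p (concat P) ⟨
  countLetter j c (p ++ concat P) ∎
  where open ≡-Reasoning

sum-middleShape : ∀ P as bs → SameLengths P as bs → sum (middleShape P as) ≡ sum (shape P) + sum as
sum-middleShape [] [] [] _ = refl
sum-middleShape (p ∷ P) (a ∷ as) (b ∷ bs) ls rewrite sum-middleShape P as bs (SameLengths-tail ls) =
  solve 4 (λ x y u v → (x :+ y) :+ (u :+ v) := (x :+ u) :+ (y :+ v)) refl (length p) a (sum (shape P)) (sum as)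

sum-outerShape : ∀ P as bs → SameLengths P as bs → sum (outerShape P as bs) ≡ sum (middleShape P as) + sum bs
sum-outerShape [] [] [] _ = refl
sum-outerShape (p ∷ P) (a ∷ as) (b ∷ bs) ls rewrite sum-outerShape P as bs (SameLengths-tail ls) =
  solve 4 (λ x y u v → (x :+ y) :+ (u :+ v) := (x :+ u) :+ (y :+ v)) refl (length p + a) b (sum (middleShape P as)) (sum bs)

sum-middle : ∀ n R → TopLayer n R → sum (map (middle n) R) ≡ sum (shape (map (lower n) R)) + sum (map (#top n) R)
sum-middle n R t = trans (cong sum middle-attachTop-split) (sum-middleShape _ _ _ (SameLengths-split n R))
  where open TopLayer t

sum-outer : ∀ n R → TopLayer n R → sum (shape R) ≡ sum (map (middle n) R) + sum (map (#topBar n) R)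
sum-outer n R t =
  trans (cong sum shape-attachTop-split)
        (trans (sum-outerShape _ _ _ (SameLengths-split n R))
               (cong (λ x → sum x + sum (map (#topBar n) R)) (sym middle-attachTop-split)))
  where open TopLayer t

letterBalance : ℕ → List Letter → ℤ
letterBalance i es = ℤ.+ countLetter i false es ℤ.- ℤ.+ countLetter i true es

wordWeight : (n : ℕ) → List Letter → Vec ℤ n
wordWeight n es = Vec.tabulate λ (k : Fin n) → letterBalance (suc (toℕ k)) es

letterBalance-lower : ∀ n R j → PaddedKing (suc n) R → j ≤ n →
                      letterBalance j (concat R) ≡ letterBalance j (concat (lowerRows n R))
letterBalance-lower n R j k le = cong₂ (λ u v → ℤ.+ u ℤ.- ℤ.+ v) (same false) (same true)
  where
  open TopLayer (peelTop n R k)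
  same : ∀ c → countLetter j c (concat R) ≡ countLetter j c (concat (lowerRows n R))
  same c = begin
    countLetter j c (concat R)                                 ≡⟨ cong (countLetter j c ∘ concat) split ⟩
    countLetter j c (concat (attachTop n (map (lower n) R) _ _)) ≡⟨ countLetter-attachTop n j c _ _ _ (SameLengths-split n R) le ⟩
    countLetter j c (concat (map (lower n) R))                 ≡⟨ cong (countLetter j c ∘ concat) lastEmpty ⟩
    countLetter j c (concat (lowerRows n R ∷ʳ []))             ≡⟨ cong (countLetter j c) (trans (sym (concat-++ (lowerRows n R) ([] ∷ []))) (++-identityʳ _)) ⟩
    countLetter j c (concat (lowerRows n R))                   ∎
    where open ≡-Reasoning

-- Complements in the rectangle with g columns

module _ (g : ℕ) where

  -- dual x = reverse (map (g ∸_) x), by recursion so that it unfolds at the end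
  dual : List ℕ → List ℕ
  dual []       = []
  dual (a ∷ as) = dual as ∷ʳ (g ∸ a)

  dual≡reverse-map : ∀ xs → dual xs ≡ reverse (map (g ∸_) xs)
  dual≡reverse-map []       = refl
  dual≡reverse-map (a ∷ as) =
    trans (cong (_∷ʳ (g ∸ a)) (dual≡reverse-map as)) (sym (unfold-reverse (g ∸ a) (map (g ∸_) as)))

  dual-∷ʳ : ∀ ys c → dual (ys ∷ʳ c) ≡ (g ∸ c) ∷ dual ys
  dual-∷ʳ []       c = refl
  dual-∷ʳ (y ∷ ys) c = cong (_∷ʳ (g ∸ y)) (dual-∷ʳ ys c)

  length-dual : ∀ xs → length (dual xs) ≡ length xs
  length-dual []       = refl
  length-dual (a ∷ as) = trans (length-∷ʳ (dual as) _) (cong suc (length-dual as))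

  dual-involutive : ∀ {xs} → All (_≤ g) xs → dual (dual xs) ≡ xs
  dual-involutive {[]}     _        = refl
  dual-involutive {a ∷ as} (le ∷ ls) =
    trans (dual-∷ʳ (dual as) (g ∸ a)) (cong₂ _∷_ (m∸[m∸n]≡n le) (dual-involutive ls))

  dual-bounded : ∀ xs → All (_≤ g) (dual xs)
  dual-bounded []       = []
  dual-bounded (a ∷ as) = All.∷ʳ⁺ (dual-bounded as) (m∸n≤m g a)

  sum-dual : ∀ {x} → All (_≤ g) x → sum (dual x) + sum x ≡ length x * g
  sum-dual {[]}     _         = refl
  sum-dual {a ∷ as} (le ∷ ls) = begin
    sum (dual as ∷ʳ (g ∸ a)) + (a + sum as)        ≡⟨ cong (_+ (a + sum as)) (trans (sum-++ (dual as) _) (cong (sum (dual as) +_) (+-identityʳ _))) ⟩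
    sum (dual as) + (g ∸ a) + (a + sum as)         ≡⟨ solve 4 (λ r d a' s → (r :+ d) :+ (a' :+ s) := (d :+ a') :+ (r :+ s)) refl (sum (dual as)) (g ∸ a) a (sum as) ⟩
    (g ∸ a + a) + (sum (dual as) + sum as)         ≡⟨ cong₂ _+_ (m∸n+n≡m le) (sum-dual ls) ⟩
    g + length as * g                              ∎
    where open ≡-Reasoning

  sum-dual-length : ∀ {x k} → All (_≤ g) x → length x ≡ k → sum (dual x) + sum x ≡ k * g
  sum-dual-length {x} bx refl = sum-dual bx

  LastAtLeast : ℕ → List ℕ → Set
  LastAtLeast b []           = ⊤
  LastAtLeast b (x ∷ [])     = b ≤ x
  LastAtLeast b (_ ∷ y ∷ ys) = LastAtLeast b (y ∷ ys)

  LastAtLeast-∷ʳ : ∀ {b c} zs → b ≤ c → LastAtLeast b (zs ∷ʳ c)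
  LastAtLeast-∷ʳ []           le = le
  LastAtLeast-∷ʳ (_ ∷ [])     le = le
  LastAtLeast-∷ʳ (_ ∷ z ∷ zs) le = LastAtLeast-∷ʳ (z ∷ zs) le

  ≺-∷ʳ : ∀ {xs ys a b} → xs ≺ ys → a ≤ b → LastAtLeast b xs → xs ∷ʳ a ≺ ys ∷ʳ b
  ≺-∷ʳ {[]}         {[]}         _               le _  = le , z≤n , tt
  ≺-∷ʳ {_ ∷ []}     {_ ∷ []}     (le₁ , _ , _)   le ll = le₁ , ll , le , z≤n , tt
  ≺-∷ʳ {_ ∷ _ ∷ _}  {_ ∷ _ ∷ _}  (le₁ , h , il)  le ll = le₁ , h , ≺-∷ʳ il le ll

  dual-≺ : ∀ {x y} → x ≺ y → dual y ≺ dual x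
  dual-≺ {[]}     {[]}     _             = tt
  dual-≺ {a ∷ as} {b ∷ bs} (le , h , il) = ≺-∷ʳ (dual-≺ il) (∸-monoʳ-≤ g le) (lastAtLeast bs h)
    where
    lastAtLeast : ∀ ys → columns ys ≤ a → LastAtLeast (g ∸ a) (dual ys)
    lastAtLeast []       _  = tt
    lastAtLeast (y ∷ ys) h' = LastAtLeast-∷ʳ (dual ys) (∸-monoʳ-≤ g h')

  dual-decreasing : ∀ {x} → Decreasing x → Decreasing (dual x)
  dual-decreasing d = ≺-decreasingˡ (dual-≺ (≺-refl d))

-- c = size of the strip; a, p, b = |α|, |π|, |β|; K, Λ, M = |κ|, |λ|, |μ|; SA, SB = #(n + 1), #(n + 1 bar)
layer-size : ∀ {g n c a b p K Λ M SA SB} → c + a + b ≡ p + p → a + K ≡ n * g → p + Λ ≡ suc n * g →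
             b + M ≡ suc n * g → K + SA ≡ Λ → Λ + SB ≡ M → c + SA ≡ g + SB
layer-size {g} {n} {c} {a} {b} {p} {K} {Λ} {M} {SA} {SB} size α+κ π+λ β+μ κ+A λ+B =
  +-cancelʳ-≡ X (c + SA) (g + SB) (trans lhs (sym rhs))
  where
  open ≡-Reasoning
  X = a + b + (Λ + Λ) + K
  lhs : c + SA + X ≡ suc n * g + suc n * g + Λ
  lhs = begin
    c + SA + X                        ≡⟨ solve 6 (λ c SA a b Λ K → c :+ SA :+ (a :+ b :+ (Λ :+ Λ) :+ K)
                                                  := (c :+ a :+ b) :+ (K :+ SA) :+ (Λ :+ Λ))
                                              refl c SA a b Λ K ⟩
    (c + a + b) + (K + SA) + (Λ + Λ)  ≡⟨ cong₂ (λ u v → u + v + (Λ + Λ)) size κ+A ⟩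
    (p + p) + Λ + (Λ + Λ)             ≡⟨ solve 2 (λ p Λ → p :+ p :+ Λ :+ (Λ :+ Λ) := (p :+ Λ) :+ (p :+ Λ) :+ Λ) refl p Λ ⟩
    (p + Λ) + (p + Λ) + Λ             ≡⟨ cong (λ w → w + w + Λ) π+λ ⟩
    suc n * g + suc n * g + Λ         ∎
  rhs : g + SB + X ≡ suc n * g + suc n * g + Λ
  rhs = begin
    g + SB + X                        ≡⟨ solve 6 (λ g SB a b Λ K → g :+ SB :+ (a :+ b :+ (Λ :+ Λ) :+ K)
                                                  := (g :+ (a :+ K)) :+ (b :+ (Λ :+ SB)) :+ Λ)
                                              refl g SB a b Λ K ⟩
    (g + (a + K)) + (b + (Λ + SB)) + Λ ≡⟨ cong₂ (λ u v → g + u + (b + v) + Λ) α+κ λ+B ⟩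
    (g + n * g) + (b + M) + Λ          ≡⟨ cong (λ w → suc n * g + w + Λ) β+μ ⟩
    suc n * g + suc n * g + Λ         ∎

difference-from-sum : ∀ m n p q → m + n ≡ p + q → ℤ.+ p ℤ.- ℤ.+ m ≡ ℤ.+ n ℤ.- ℤ.+ q
difference-from-sum m n p q e = begin
  ℤ.+ p ℤ.- ℤ.+ m       ≡⟨ ℤ.[+m]-[+n]≡m⊖n p m ⟩
  p ℤ.⊖ m               ≡⟨ ℤ.+-cancelˡ-⊖ q p m ⟨
  (q + p) ℤ.⊖ (q + m)   ≡⟨ cong₂ ℤ._⊖_ (trans (+-comm q p) (sym e)) (+-comm q m) ⟩
  (m + n) ℤ.⊖ (m + q)   ≡⟨ ℤ.+-cancelˡ-⊖ m n q ⟩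
  n ℤ.⊖ q               ≡⟨ ℤ.[+m]-[+n]≡m⊖n n q ⟨
  ℤ.+ n ℤ.- ℤ.+ q       ∎
  where open ≡-Reasoning

tabulate-∷ʳ : ∀ {X : Set} n (h : Fin (suc n) → X) → Vec.tabulate h ≡ Vec.tabulate (h ∘ inject₁) ∷ʳᵥ h (fromℕ n)
tabulate-∷ʳ zero    h = refl
tabulate-∷ʳ (suc n) h = cong (h Fin.zero ∷_) (tabulate-∷ʳ n (h ∘ Fin.suc))

-- The bijection

module _ (g : ℕ) where

  -- layer n + 1 of R becomes the strip dual κ ∷ʳ 0 → dual λ → dual μ
  layerStrip : ℕ → Rows → Strip
  layerStrip n R =
    canonicalStrip (dual g (shape (lowerRows n R)) ∷ʳ 0) (dual g (map (middle n) R)) (dual g (shape R))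

  toSSOT : (n : ℕ) → Rows → Vec Strip n
  toSSOT zero    R = []
  toSSOT (suc n) R = toSSOT n (lowerRows n R) ∷ʳᵥ layerStrip n R

  -- λ and μ read back from the last strip
  lastMiddle lastOuter : ∀ n → Vec Strip (suc n) → List ℕ
  lastMiddle n T = dual g (pad (suc n) (peak (inside (Vec.last T)) (rest (Vec.last T))))
  lastOuter  n T = dual g (pad (suc n) (outside (Vec.last T)))

  fromSSOT : (n : ℕ) → Vec Strip n → Rows
  fromSSOT zero    _ = []
  fromSSOT (suc n) T = extension n (fromSSOT n (Vec.init T)) (lastMiddle n T) (lastOuter n T)

  record LayerFacts (n : ℕ) (R : Rows) : Set where
    field
      layer        : TopLayer n R
      shape-lower  : shape (map (lower n) R) ≡ shape (lowerRows n R) ∷ʳ 0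
      outer≤g      : All (_≤ g) (shape R)
      middle≤g     : All (_≤ g) (map (middle n) R)
      inner≤g      : All (_≤ g) (shape (lowerRows n R))
      inside≺peak  : dual g (shape (lowerRows n R)) ∷ʳ 0 ≺ dual g (map (middle n) R)
      outside≺peak : dual g (shape R) ≺ dual g (map (middle n) R)

  dual-shift : ∀ κ lm → κ ∷ʳ 0 ≺ lm → columns lm ≤ g → dual g κ ∷ʳ 0 ≺ dual g lm
  dual-shift κ lm il h = subst (λ c → dual g κ ∷ʳ c ≺ dual g lm) (n∸n≡0 g) (dual-≺ g (≺-shift il h))

  dual-unshift : ∀ κ π → dual g κ ∷ʳ 0 ≺ π → columns π ≤ g → All (_≤ g) κ → κ ∷ʳ 0 ≺ dual g π
  dual-unshift κ π il h bκ =
    subst (_≺ dual g π) (cong₂ _∷ʳ_ (dual-involutive g bκ) (n∸n≡0 g)) (dual-≺ g (≺-shift {dual g κ} {π} il h))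

  columns≤ : ∀ {x} → All (_≤ g) x → columns x ≤ g
  columns≤ []      = z≤n
  columns≤ (p ∷ _) = p

  layerFacts : ∀ n R → PaddedKing (suc n) R → columns (shape R) ≤ g → LayerFacts n R
  layerFacts n R k hμ = record
    { layer = layer ; shape-lower = shape-lower ; outer≤g = outer≤g ; middle≤g = middle≤g
    ; inner≤g = inner≤g ; inside≺peak = dual-shift κ (map (middle n) R) inner≺middle' (columns≤ middle≤g)
    ; outside≺peak = dual-≺ g middle≺outer }
    where
    layer = peelTop n R k
    open TopLayer layer
    κ = shape (lowerRows n R)
    shape-lower : shape (map (lower n) R) ≡ κ ∷ʳ 0
    shape-lower = trans (cong shape lastEmpty) (shape-∷ʳ[] (lowerRows n R))
    outer≤g = decreasing-bounded (≺-decreasingʳ middle≺outer) hμ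
    middle≤g = ≺-bounded middle≺outer outer≤g
    inner≺middle' : κ ∷ʳ 0 ≺ map (middle n) R
    inner≺middle' = subst (_≺ map (middle n) R) shape-lower inner≺middle
    inner≤g = All.++⁻ˡ κ (≺-bounded inner≺middle' middle≤g)

  layerStrip-IsOHS : ∀ n R → LayerFacts n R → IsOHS (layerStrip n R)
  layerStrip-IsOHS n R f = canonicalStrip-IsOHS inside≺peak outside≺peak
    where open LayerFacts f

  layerStrip-columns : ∀ n R → LayerFacts n R → ColumnsAtMost g (partsOf (layerStrip n R))
  layerStrip-columns n R f = canonicalStrip-columns inside≺peak outside≺peak (columns≤ (dual-bounded g (map (middle n) R)))
    where open LayerFacts f

  toSSOT-valid : ∀ n R → PaddedKing n R → columns (shape R) ≤ g →
                 IsSSOT g (dropZeros (dual g (shape R))) n (toSSOT n R)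
  toSSOT-valid zero    []      _ _  = tt , refl , z≤n
  toSSOT-valid (suc n) R       k hμ =
    subst (λ ν → IsSSOT g ν (suc n) (toSSOT (suc n) R))
          (canonicalStrip-outside inside≺peak outside≺peak)
          (IsSSOT-∷ʳ⁺ (toSSOT n P) (layerStrip n R)
                      (toSSOT-valid n P (TopLayer.restKing layer) (columns≤ inner≤g))
                      (layerStrip-IsOHS n R facts) (dropZeros-∷ʳ0 (dual g (shape P)))
                      (layerStrip-columns n R facts))
    where
    P = lowerRows n R
    facts = layerFacts n R k hμ
    open LayerFacts facts

  dual-pad-dual : ∀ n {x} → Decreasing x → All (_≤ g) x → length x ≡ n → dual g (pad n (dropZeros (dual g x))) ≡ x
  dual-pad-dual n {x} dx bx lx =
    trans (cong (dual g) (pad-dropZeros (dual-decreasing g dx) (trans (length-dual g x) lx))) (dual-involutive g bx)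

  lastMiddle-∷ʳ : ∀ n (T : Vec Strip n) s → lastMiddle n (T ∷ʳᵥ s) ≡ dual g (pad (suc n) (peak (inside s) (rest s)))
  lastMiddle-∷ʳ n T s = cong (λ s' → dual g (pad (suc n) (peak (inside s') (rest s')))) (Vec.last-∷ʳ s T)

  lastOuter-∷ʳ : ∀ n (T : Vec Strip n) s → lastOuter n (T ∷ʳᵥ s) ≡ dual g (pad (suc n) (outside s))
  lastOuter-∷ʳ n T s = cong (λ s' → dual g (pad (suc n) (outside s'))) (Vec.last-∷ʳ s T)

  fromSSOT-∷ʳ : ∀ n (T : Vec Strip n) s → fromSSOT (suc n) (T ∷ʳᵥ s) ≡
                extension n (fromSSOT n T) (dual g (pad (suc n) (peak (inside s) (rest s))))
                                           (dual g (pad (suc n) (outside s)))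
  fromSSOT-∷ʳ n T s =
    cong₂ (λ X (lu : List ℕ × List ℕ) → extension n X (proj₁ lu) (proj₂ lu))
          (cong (fromSSOT n) (Vec.init-∷ʳ s T)) (cong₂ _,_ (lastMiddle-∷ʳ n T s) (lastOuter-∷ʳ n T s))

  fromSSOT-toSSOT : ∀ n R → PaddedKing n R → columns (shape R) ≤ g → fromSSOT n (toSSOT n R) ≡ R
  fromSSOT-toSSOT zero    []      _ _  = refl
  fromSSOT-toSSOT (suc n) R       k hμ = begin
    fromSSOT (suc n) (toSSOT n P ∷ʳᵥ layerStrip n R)
      ≡⟨ fromSSOT-∷ʳ n (toSSOT n P) (layerStrip n R) ⟩
    extension n (fromSSOT n (toSSOT n P))
                (dual g (pad (suc n) (peak (inside (layerStrip n R)) (rest (layerStrip n R)))))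
                (dual g (pad (suc n) (outside (layerStrip n R))))
      ≡⟨ cong₂ (λ X (lu : List ℕ × List ℕ) → extension n X (proj₁ lu) (proj₂ lu))
               (fromSSOT-toSSOT n P (TopLayer.restKing layer) (columns≤ inner≤g))
               (cong₂ _,_ middleE outerE) ⟩
    extension n P (map (middle n) R) (shape R)
      ≡⟨ extension-peelTop n R layer ⟩
    R ∎
    where
    open ≡-Reasoning
    P = lowerRows n R
    open LayerFacts (layerFacts n R k hμ)
    open TopLayer layer using (inner≺middle; middle≺outer)
    lenR : length (shape R) ≡ suc n
    lenR = trans (length-map length R) (PaddedKing.rows-length k)
    middleE : dual g (pad (suc n) (peak (inside (layerStrip n R)) (rest (layerStrip n R)))) ≡ map (middle n) R
    middleE = trans (cong (λ x → dual g (pad (suc n) x)) (peak-canonical inside≺peak outside≺peak))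
                    (dual-pad-dual (suc n) (≺-decreasingʳ inner≺middle) middle≤g (trans (length-map _ R) (PaddedKing.rows-length k)))
    outerE : dual g (pad (suc n) (outside (layerStrip n R))) ≡ shape R
    outerE = trans (cong (λ x → dual g (pad (suc n) x)) (canonicalStrip-outside inside≺peak outside≺peak))
                   (dual-pad-dual (suc n) (≺-decreasingʳ middle≺outer) outer≤g lenR)

  toSSOT-extension : ∀ n P lm mu → Extension n P lm mu →
                     toSSOT (suc n) (extension n P lm mu) ≡
                     toSSOT n P ∷ʳᵥ canonicalStrip (dual g (shape P) ∷ʳ 0) (dual g lm) (dual g mu)
  toSSOT-extension n P lm mu e = cong₂ _∷ʳᵥ_ (cong (toSSOT n) lowerE) (cong₂ strip' lowerE (cong₂ _,_ middle-ext shape-ext))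
    where
    open Extension e
    lowerE : lowerRows n (extension n P lm mu) ≡ P
    lowerE = trans (cong dropLast lower-ext) (dropLast-∷ʳ P [])
    strip' : Rows → List ℕ × List ℕ → Strip
    strip' X lu = canonicalStrip (dual g (shape X) ∷ʳ 0) (dual g (proj₁ lu)) (dual g (proj₂ lu))

  record LastStrip (n : ℕ) (T : Vec Strip n) (S : Strip) (s : List ℕ) : Set where
    field
      initSSOT  : IsSSOT g (outsideFrom [] T) n T
      partition : IsPartition (outsideFrom [] T)
      rows≤     : length (outsideFrom [] T) ≤ n
      columns≤g : columns (outsideFrom [] T) ≤ g
      π         : List ℕ
      canonicalS : S ≡ canonicalStrip (pad (suc n) (outsideFrom [] T)) π (dual g s)
      inside≺π  : pad (suc n) (outsideFrom [] T) ≺ π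
      outside≺π : dual g s ≺ π
      π≤g       : columns π ≤ g

    padded≤g : All (_≤ g) (pad n (outsideFrom [] T))
    padded≤g = All.++⁺ (All.map (λ q → ≤-trans q columns≤g) (partition-bounded partition)) (All.replicate⁺ _ z≤n)

  lastStrip : ∀ n T S s → IsSSOT g (dropZeros (dual g s)) (suc n) (T ∷ʳᵥ S) →
              length s ≡ suc n → Decreasing s → LastStrip n T S s
  lastStrip n T S s ssot ls ds = record
    { initSSOT = initSSOT ; partition = partition ; rows≤ = rows≤ ; columns≤g = columns≤g
    ; π = proj₁ canon ; canonicalS = proj₁ (proj₂ canon) ; inside≺π = proj₁ (proj₂ (proj₂ canon))
    ; outside≺π = proj₁ (proj₂ (proj₂ (proj₂ canon))) ; π≤g = proj₂ (proj₂ (proj₂ (proj₂ canon))) }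
    where
    parts = IsSSOT-∷ʳ⁻ T S ssot
    initSSOT = proj₁ parts
    ohs = proj₁ (proj₂ parts)
    inE = proj₁ (proj₂ (proj₂ parts))
    outE = proj₁ (proj₂ (proj₂ (proj₂ parts)))
    cols = proj₂ (proj₂ (proj₂ (proj₂ parts)))
    ν = outsideFrom [] T
    partition : IsPartition ν
    partition = subst IsPartition inE (All.head (proj₁ ohs))
    rows≤ = Chained-length [] T (proj₁ initSSOT)
    columns≤g = subst (λ x → columns x ≤ g) inE (All.head cols)
    α = pad (suc n) ν
    lenα : length α ≡ suc n
    lenα = length-pad (suc n) ν (≤-trans rows≤ (n≤1+n n))
    canon = IsOHS-canonical S α (dual g s) ohs cols (trans inE (sym (dropZeros-pad (suc n) (proj₂ partition)))) outE
              (pad-decreasing (suc n) partition) (dual-decreasing g ds) (trans (length-dual g s) (trans ls (sym lenα)))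
              (subst (_< length α) (cong length (sym (dropZeros-pad (suc n) (proj₂ partition))))
                     (≤-trans (s≤s rows≤) (≤-reflexive (sym lenα))))

  fromSSOT-lastStrip : ∀ n T S s → (l : LastStrip n T S s) → Decreasing s → All (_≤ g) s → length s ≡ suc n →
                       fromSSOT (suc n) (T ∷ʳᵥ S) ≡ extension n (fromSSOT n T) (dual g (LastStrip.π l)) s
  fromSSOT-lastStrip n T S s l ds s≤g ls =
    trans (fromSSOT-∷ʳ n T S) (cong₂ (extension n (fromSSOT n T)) middleE outerE)
    where
    open LastStrip l
    open ≡-Reasoning
    lenπ : length π ≡ suc n
    lenπ = trans (sym (≺-length outside≺π)) (trans (length-dual g s) ls)
    S₀ = canonicalStrip (pad (suc n) (outsideFrom [] T)) π (dual g s)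
    middleE : dual g (pad (suc n) (peak (inside S) (rest S))) ≡ dual g π
    middleE = begin
      dual g (pad (suc n) (peak (inside S) (rest S)))    ≡⟨ cong (λ S' → dual g (pad (suc n) (peak (inside S') (rest S')))) canonicalS ⟩
      dual g (pad (suc n) (peak (inside S₀) (rest S₀)))  ≡⟨ cong (λ x → dual g (pad (suc n) x)) (peak-canonical inside≺π outside≺π) ⟩
      dual g (pad (suc n) (dropZeros π))                 ≡⟨ cong (dual g) (pad-dropZeros (≺-decreasingʳ inside≺π) lenπ) ⟩
      dual g π                                           ∎
    outerE : dual g (pad (suc n) (outside S)) ≡ s
    outerE = begin
      dual g (pad (suc n) (outside S))                 ≡⟨ cong (λ S' → dual g (pad (suc n) (outside S'))) canonicalS ⟩
      dual g (pad (suc n) (outside S₀))                ≡⟨ cong (λ x → dual g (pad (suc n) x)) (canonicalStrip-outside inside≺π outside≺π) ⟩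
      dual g (pad (suc n) (dropZeros (dual g s)))      ≡⟨ dual-pad-dual (suc n) ds s≤g ls ⟩
      s                                                ∎

  Preimage : ∀ n → Vec Strip n → List ℕ → Set
  Preimage n T s = PaddedKing n (fromSSOT n T) × shape (fromSSOT n T) ≡ s × toSSOT n (fromSSOT n T) ≡ T

  fromSSOT-valid : ∀ n T s → IsSSOT g (dropZeros (dual g s)) n T → length s ≡ n → Decreasing s → columns s ≤ g →
                   Preimage n T s
  fromSSOT-valid-∷ʳ : ∀ n T' S s → IsSSOT g (dropZeros (dual g s)) (suc n) (T' ∷ʳᵥ S) → length s ≡ suc n →
                      Decreasing s → columns s ≤ g → Preimage (suc n) (T' ∷ʳᵥ S) s

  fromSSOT-valid zero    [] [] _ _ _ _ = paddedKing refl [] [] tt tt , refl , refl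
  fromSSOT-valid (suc n) T  s  ssot ls ds hs =
    subst (λ T → Preimage (suc n) T s) (sym (Vec-eta T))
          (fromSSOT-valid-∷ʳ n (Vec.init T) (Vec.last T) s (subst (IsSSOT g _ (suc n)) (Vec-eta T) ssot) ls ds hs)

  fromSSOT-valid-∷ʳ n T' S s ssot ls ds hs =
    subst (PaddedKing (suc n)) (sym fromE) (Extension.king ext) ,
    trans (cong shape fromE) (Extension.shape-ext ext) ,
    trans (cong (toSSOT (suc n)) fromE) toE
    where
    last = lastStrip n T' S s ssot ls ds
    open LastStrip last
    ν = outsideFrom [] T'
    padν = pad n ν
    κ = dual g padν
    IH = fromSSOT-valid n T' κ
           (subst (λ ν' → IsSSOT g ν' n T') (sym (trans (cong dropZeros (dual-involutive g padded≤g)) (dropZeros-pad n (proj₂ partition))))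
                  initSSOT)
           (trans (length-dual g padν) (length-pad n ν rows≤)) (dual-decreasing g (pad-decreasing n partition))
           (columns≤ (dual-bounded g padν))
    P = fromSSOT n T'
    shapeP : shape P ≡ κ
    shapeP = proj₁ (proj₂ IH)
    αE : pad (suc n) ν ≡ dual g (shape P) ∷ʳ 0
    αE = trans (pad-suc n ν rows≤) (cong (_∷ʳ 0) (trans (sym (dual-involutive g padded≤g)) (cong (dual g) (sym shapeP))))
    s≤g = decreasing-bounded ds hs
    π≤g′ = decreasing-bounded (≺-decreasingʳ inside≺π) π≤g
    ext = extend n P (dual g π) s (proj₁ IH)
            (subst (λ x → x ∷ʳ 0 ≺ dual g π) (sym shapeP)
                   (dual-unshift κ π (subst (_≺ π) (trans αE (cong (λ x → dual g x ∷ʳ 0) shapeP)) inside≺π) π≤g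
                                 (dual-bounded g padν)))
            (subst (dual g π ≺_) (dual-involutive g s≤g) (dual-≺ g outside≺π))
    fromE : fromSSOT (suc n) (T' ∷ʳᵥ S) ≡ extension n P (dual g π) s
    fromE = fromSSOT-lastStrip n T' S s last ds s≤g ls
    toE : toSSOT (suc n) (extension n P (dual g π) s) ≡ T' ∷ʳᵥ S
    toE = trans (toSSOT-extension n P (dual g π) s ext)
                (cong₂ _∷ʳᵥ_ (proj₂ (proj₂ IH))
                       (trans (cong₂ (λ a p → canonicalStrip a p (dual g s)) (sym αE) (dual-involutive g π≤g′))
                              (sym canonicalS)))

  layerStrip-weight : ∀ n R → PaddedKing (suc n) R → columns (shape R) ≤ g →
                      ℤ.+ g ℤ.- ℤ.+ size (layerStrip n R) ≡ letterBalance (suc n) (concat R)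
  layerStrip-weight n R k hμ = difference-from-sum (size (layerStrip n R)) (countLetter (suc n) false (concat R)) g
                                                   (countLetter (suc n) true (concat R)) sizeBalance
    where
    P = lowerRows n R
    facts = layerFacts n R k hμ
    open LayerFacts facts
    open TopLayer layer using (restKing)
    κ = shape P
    lm = map (middle n) R
    lenR : length R ≡ suc n
    lenR = PaddedKing.rows-length k
    size-layer : size (layerStrip n R) + sum (dual g κ ∷ʳ 0) + sum (dual g (shape R)) ≡ sum (dual g lm) + sum (dual g lm)
    size-layer = trans (cong (λ c → c + sum (dual g κ ∷ʳ 0) + sum (dual g (shape R)))
                             (length-map dropZeros (canonical (dual g κ ∷ʳ 0) (dual g lm) (dual g (shape R)))))
                       (length-canonical inside≺peak outside≺peak)
    α+κ : sum (dual g κ ∷ʳ 0) + sum κ ≡ n * g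
    α+κ = trans (cong (_+ sum κ) (sum-∷ʳ0 (dual g κ)))
                (sum-dual-length g inner≤g (trans (length-map length P) (PaddedKing.rows-length restKing)))
    π+λ : sum (dual g lm) + sum lm ≡ suc n * g
    π+λ = sum-dual-length g middle≤g (trans (length-map _ R) lenR)
    β+μ : sum (dual g (shape R)) + sum (shape R) ≡ suc n * g
    β+μ = sum-dual-length g outer≤g (trans (length-map _ R) lenR)
    κ+A : sum κ + sum (map (#top n) R) ≡ sum lm
    κ+A = sym (trans (sum-middle n R layer)
                     (cong (_+ sum (map (#top n) R)) (trans (cong sum shape-lower) (sum-∷ʳ0 κ))))
    sizeBalance : size (layerStrip n R) + countLetter (suc n) false (concat R) ≡ g + countLetter (suc n) true (concat R)
    sizeBalance = begin
      size (layerStrip n R) + countLetter (suc n) false (concat R) ≡⟨ cong (size (layerStrip n R) +_) (countLetter-concat (suc n) false R) ⟩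
      size (layerStrip n R) + sum (map (#top n) R)
        ≡⟨ layer-size {g} {n} {size (layerStrip n R)} {sum (dual g κ ∷ʳ 0)} {sum (dual g (shape R))} {sum (dual g lm)}
                      {sum κ} {sum lm} {sum (shape R)} {sum (map (#top n) R)} {sum (map (#topBar n) R)}
                      size-layer α+κ π+λ β+μ κ+A (sym (sum-outer n R layer)) ⟩
      g + sum (map (#topBar n) R)                                 ≡⟨ cong (g +_) (countLetter-concat (suc n) true R) ⟨
      g + countLetter (suc n) true (concat R)                     ∎
      where open ≡-Reasoning

  toSSOT-weight : ∀ n R → PaddedKing n R → columns (shape R) ≤ g →
                  Vec.map (λ s → ℤ.+ g ℤ.- ℤ.+ size s) (toSSOT n R) ≡ wordWeight n (concat R)
  toSSOT-weight zero    []      _ _  = refl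
  toSSOT-weight (suc n) R       k hμ = begin
    Vec.map w (toSSOT n P ∷ʳᵥ layerStrip n R)
      ≡⟨ Vec.map-∷ʳ w (layerStrip n R) (toSSOT n P) ⟩
    Vec.map w (toSSOT n P) ∷ʳᵥ w (layerStrip n R)
      ≡⟨ cong₂ _∷ʳᵥ_ (trans (toSSOT-weight n P (TopLayer.restKing layer) (columns≤ inner≤g))
                            (Vec.tabulate-cong λ i → sym (lowerBalance i)))
                     (trans (layerStrip-weight n R k hμ) (cong (λ j → letterBalance (suc j) (concat R)) (sym (toℕ-fromℕ n)))) ⟩
    Vec.tabulate (λ i → letterBalance (suc (toℕ (inject₁ i))) (concat R)) ∷ʳᵥ letterBalance (suc (toℕ (fromℕ n))) (concat R)
      ≡⟨ tabulate-∷ʳ n (λ i → letterBalance (suc (toℕ i)) (concat R)) ⟨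
    wordWeight (suc n) (concat R) ∎
    where
    open ≡-Reasoning
    w = λ s → ℤ.+ g ℤ.- ℤ.+ size s
    P = lowerRows n R
    open LayerFacts (layerFacts n R k hμ)
    lowerBalance : ∀ (i : Fin n) → letterBalance (suc (toℕ (inject₁ i))) (concat R) ≡ letterBalance (suc (toℕ i)) (concat P)
    lowerBalance i = trans (cong (λ j → letterBalance (suc j) (concat R)) (toℕ-inject₁ i))
                           (letterBalance-lower n R (suc (toℕ i)) k (toℕ<n i))

-- Dropping and restoring empty rows

dropEmptyRows : Rows → Rows
dropEmptyRows []            = []
dropEmptyRows ([] ∷ R)      = dropEmptyRows R
dropEmptyRows ((x ∷ r) ∷ R) = (x ∷ r) ∷ dropEmptyRows R

padRows : ℕ → Rows → Rows
padRows m R = R ++ replicate (m ∸ length R) []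

below-empty : ∀ R → ColsStrict ([] ∷ R) → R ≡ replicate (length R) []
below-empty []            _        = refl
below-empty ([] ∷ R)      (_ , cs) = cong ([] ∷_) (below-empty R cs)
below-empty ((_ ∷ _) ∷ _) (() , _)

dropEmptyRows-replicate : ∀ k → dropEmptyRows (replicate k []) ≡ []
dropEmptyRows-replicate zero    = refl
dropEmptyRows-replicate (suc k) = dropEmptyRows-replicate k

dropEmptyRows-below-empty : ∀ R → ColsStrict ([] ∷ R) → dropEmptyRows R ≡ []
dropEmptyRows-below-empty R cs = trans (cong dropEmptyRows (below-empty R cs)) (dropEmptyRows-replicate (length R))

ColsStrict-dropEmptyRows : ∀ R → ColsStrict R → ColsStrict (dropEmptyRows R)
ColsStrict-dropEmptyRows []                         _        = tt
ColsStrict-dropEmptyRows ([] ∷ R)                   cs rewrite dropEmptyRows-below-empty R cs = tt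
ColsStrict-dropEmptyRows ((_ ∷ _) ∷ [])             _        = tt
ColsStrict-dropEmptyRows ((_ ∷ _) ∷ [] ∷ R)         (_ , cs) rewrite dropEmptyRows-below-empty R cs = tt
ColsStrict-dropEmptyRows ((x ∷ r) ∷ (y ∷ r') ∷ R)  (c , cs) = c , ColsStrict-dropEmptyRows ((y ∷ r') ∷ R) cs

RowsBounded-dropEmptyRows : ∀ i R → ColsStrict R → RowsBounded i R → RowsBounded i (dropEmptyRows R)
RowsBounded-dropEmptyRows i []                        _        _        = tt
RowsBounded-dropEmptyRows i ([] ∷ R)                  cs       _ rewrite dropEmptyRows-below-empty R cs = tt
RowsBounded-dropEmptyRows i ((_ ∷ _) ∷ [])            _        (b , _)  = b , tt
RowsBounded-dropEmptyRows i ((_ ∷ _) ∷ [] ∷ R)        (_ , cs) (b , _) rewrite dropEmptyRows-below-empty R cs = b , tt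
RowsBounded-dropEmptyRows i ((x ∷ r) ∷ (y ∷ r') ∷ R) (c , cs) (b , bs) =
  b , RowsBounded-dropEmptyRows (suc i) ((y ∷ r') ∷ R) cs bs

All-dropEmptyRows : ∀ {Q : List Letter → Set} R → All Q R → All Q (dropEmptyRows R)
All-dropEmptyRows []            _        = []
All-dropEmptyRows ([] ∷ R)      (_ ∷ qs) = All-dropEmptyRows R qs
All-dropEmptyRows ((_ ∷ _) ∷ R) (q ∷ qs) = q ∷ All-dropEmptyRows R qs

shape-dropEmptyRows : ∀ R → shape (dropEmptyRows R) ≡ dropZeros (shape R)
shape-dropEmptyRows []            = refl
shape-dropEmptyRows ([] ∷ R)      = shape-dropEmptyRows R
shape-dropEmptyRows ((_ ∷ r) ∷ R) = cong (suc (length r) ∷_) (shape-dropEmptyRows R)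

padRows-dropEmptyRows : ∀ R → ColsStrict R → padRows (length R) (dropEmptyRows R) ≡ R
padRows-dropEmptyRows []            _  = refl
padRows-dropEmptyRows ([] ∷ R)      cs rewrite dropEmptyRows-below-empty R cs = cong ([] ∷_) (sym (below-empty R cs))
padRows-dropEmptyRows ((x ∷ r) ∷ R) cs = cong ((x ∷ r) ∷_) (padRows-dropEmptyRows R (tail-colsStrict R cs))
  where
  tail-colsStrict : ∀ R → ColsStrict ((x ∷ r) ∷ R) → ColsStrict R
  tail-colsStrict []      _        = tt
  tail-colsStrict (_ ∷ _) (_ , cs) = cs

dropEmptyRows-nonempty : ∀ R → All (0 <_) (shape R) → dropEmptyRows R ≡ R
dropEmptyRows-nonempty []            _        = refl
dropEmptyRows-nonempty ((x ∷ r) ∷ R) (_ ∷ ps) = cong ((x ∷ r) ∷_) (dropEmptyRows-nonempty R ps)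

dropEmptyRows-padRows : ∀ m R → dropEmptyRows (padRows m R) ≡ dropEmptyRows R
dropEmptyRows-padRows m R = go R (m ∸ length R)
  where
  go : ∀ R k → dropEmptyRows (R ++ replicate k []) ≡ dropEmptyRows R
  go []            k = dropEmptyRows-replicate k
  go ([] ∷ R)      k = go R k
  go ((x ∷ r) ∷ R) k = cong ((x ∷ r) ∷_) (go R k)

ColsStrict-++empty : ∀ R k → ColsStrict R → ColsStrict (R ++ replicate k [])
ColsStrict-++empty []          zero          _        = tt
ColsStrict-++empty []          (suc zero)    _        = tt
ColsStrict-++empty []          (suc (suc k)) _        = tt , ColsStrict-++empty [] (suc k) tt
ColsStrict-++empty (_ ∷ [])    zero          _        = tt
ColsStrict-++empty (_ ∷ [])    (suc k)       _        = tt , ColsStrict-++empty [] (suc k) tt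
ColsStrict-++empty (_ ∷ r ∷ R) k             (c , cs) = c , ColsStrict-++empty (r ∷ R) k cs

RowsBounded-++empty : ∀ i R k → RowsBounded i R → RowsBounded i (R ++ replicate k [])
RowsBounded-++empty i []      zero    _        = tt
RowsBounded-++empty i []      (suc k) _        = [] , RowsBounded-++empty (suc i) [] k tt
RowsBounded-++empty i (_ ∷ R) k       (b , bs) = b , RowsBounded-++empty (suc i) R k bs

concat-padRows : ∀ m R → concat (padRows m R) ≡ concat R
concat-padRows m R = begin
  concat (R ++ replicate (m ∸ length R) [])            ≡⟨ concat-++ R (replicate (m ∸ length R) []) ⟨
  concat R ++ concat (replicate (m ∸ length R) [])     ≡⟨ cong (concat R ++_) (concat-empty (m ∸ length R)) ⟩
  concat R ++ []                                       ≡⟨ ++-identityʳ _ ⟩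
  concat R                                             ∎
  where
  open ≡-Reasoning
  concat-empty : ∀ k → concat (replicate {A = List Letter} k []) ≡ []
  concat-empty zero    = refl
  concat-empty (suc k) = concat-empty k

shape-replicate-empty : ∀ k → shape (replicate {A = List Letter} k []) ≡ replicate k 0
shape-replicate-empty zero    = refl
shape-replicate-empty (suc k) = cong (0 ∷_) (shape-replicate-empty k)

module _ {μ : List ℕ} {m : ℕ} where

  IsKing⇒PaddedKing : ∀ R → length μ ≤ m → IsKing μ m R → PaddedKing m (padRows m R) × shape (padRows m R) ≡ pad m μ
  IsKing⇒PaddedKing R lμ (shapeR , alph , weak , cols , bounded) =
    paddedKing lengthPadded (All.++⁺ alph (All.replicate⁺ _ [])) (All.++⁺ weak (All.replicate⁺ _ []))
               (ColsStrict-++empty R _ cols) (RowsBounded-++empty 1 R _ bounded) ,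
    trans (map-++ length R _) (cong₂ _++_ shapeR (trans (shape-replicate-empty _) (cong (λ x → replicate (m ∸ x) 0) lenR)))
    where
    lenR : length R ≡ length μ
    lenR = trans (sym (length-map length R)) (cong length shapeR)
    lengthPadded : length (padRows m R) ≡ m
    lengthPadded = trans (length-++ R) (trans (cong (length R +_) (length-replicate (m ∸ length R)))
                                                (m+[n∸m]≡n (subst (_≤ m) (sym lenR) lμ)))

  PaddedKing⇒IsKing : ∀ R → IsPartition μ → PaddedKing m R → shape R ≡ pad m μ → IsKing μ m (dropEmptyRows R)
  PaddedKing⇒IsKing R pμ (paddedKing _ alph weak cols bounded) shapeR =
    trans (shape-dropEmptyRows R) (trans (cong dropZeros shapeR) (dropZeros-pad m (proj₂ pμ))) ,
    All-dropEmptyRows R alph , All-dropEmptyRows R weak , ColsStrict-dropEmptyRows R cols ,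
    RowsBounded-dropEmptyRows 1 R cols bounded

module _ (m g : ℕ) (μ : List ℕ) (pμ : IsPartition μ) (lμ : length μ ≤ m) (bμ : All (_≤ g) μ) where

  private
    s = pad m μ
    s≤g : columns s ≤ g
    s≤g = ≤-trans (columns-pad m μ) (columns≤ g bμ)
    complementE : dropZeros (dual g s) ≡ complement m g μ
    complementE = cong dropZeros (dual≡reverse-map g s)

    preimage : ∀ T → IsSSOT g (complement m g μ) m T → Preimage g m T s
    preimage T ssot = fromSSOT-valid g m T s (subst (λ ν → IsSSOT g ν m T) (sym complementE) ssot)
                                     (length-pad m μ lμ) (pad-decreasing m pμ) s≤g

    padded-columns≤ : ∀ {R} → IsKing μ m R → columns (shape (padRows m R)) ≤ g
    padded-columns≤ {R} king = subst (λ x → columns x ≤ g) (sym (proj₂ (IsKing⇒PaddedKing R lμ king))) s≤g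

  kingToSSOT : KingTableau μ m → SSOT g (complement m g μ) m
  kingToSSOT (R , king) =
    toSSOT g m (padRows m R) ,
    subst (λ ν → IsSSOT g ν m (toSSOT g m (padRows m R)))
          (trans (cong (dropZeros ∘ dual g) (proj₂ padded)) complementE)
          (toSSOT-valid g m (padRows m R) (proj₁ padded) (padded-columns≤ king))
    where padded = IsKing⇒PaddedKing R lμ king

  ssotToKing : SSOT g (complement m g μ) m → KingTableau μ m
  ssotToKing (T , ssot) = dropEmptyRows (fromSSOT g m T) , PaddedKing⇒IsKing (fromSSOT g m T) pμ (proj₁ pre) (proj₁ (proj₂ pre))
    where pre = preimage T ssot

  kingToSSOT-ssotToKing : ∀ {x y} → proj₁ y ≡ proj₁ (ssotToKing x) → proj₁ (kingToSSOT y) ≡ proj₁ x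
  kingToSSOT-ssotToKing {T , ssot} refl = begin
    toSSOT g m (padRows m (dropEmptyRows G))             ≡⟨ cong (λ k → toSSOT g m (padRows k (dropEmptyRows G))) (sym lenG) ⟩
    toSSOT g m (padRows (length G) (dropEmptyRows G))    ≡⟨ cong (toSSOT g m) (padRows-dropEmptyRows G (PaddedKing.colsStrict king)) ⟩
    toSSOT g m G                                         ≡⟨ proj₂ (proj₂ pre) ⟩
    T                                                    ∎
    where
    open ≡-Reasoning
    G = fromSSOT g m T
    pre = preimage T ssot
    king = proj₁ pre
    lenG = PaddedKing.rows-length king

  ssotToKing-kingToSSOT : ∀ {x y} → proj₁ y ≡ proj₁ (kingToSSOT x) → proj₁ (ssotToKing y) ≡ proj₁ x
  ssotToKing-kingToSSOT {R , king} refl = begin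
    dropEmptyRows (fromSSOT g m (toSSOT g m (padRows m R)))  ≡⟨ cong dropEmptyRows (fromSSOT-toSSOT g m (padRows m R) (proj₁ (IsKing⇒PaddedKing R lμ king)) (padded-columns≤ king)) ⟩
    dropEmptyRows (padRows m R)                             ≡⟨ dropEmptyRows-padRows m R ⟩
    dropEmptyRows R                                         ≡⟨ dropEmptyRows-nonempty R (subst (All (0 <_)) (sym (proj₁ king)) (proj₂ pμ)) ⟩
    R                                                       ∎
    where
    open ≡-Reasoning

  Ψ : Inverse (KingSetoid μ m) (SSOTSetoid g (complement m g μ) m)
  Ψ = record
    { to        = kingToSSOT
    ; from      = ssotToKing
    ; to-cong   = λ { {_ , _} refl → refl }
    ; from-cong = λ { {_ , _} refl → refl }
    ; inverse   = (λ {x} {y} → kingToSSOT-ssotToKing {x} {y}) , (λ {x} {y} → ssotToKing-kingToSSOT {x} {y})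
    }

  Ψ-weight : ∀ t → ssotWeight g m (kingToSSOT t) ≡ kingWeight m t
  Ψ-weight (R , king) =
    trans (toSSOT-weight g m (padRows m R) (proj₁ (IsKing⇒PaddedKing R lμ king)) (padded-columns≤ king))
          (cong (wordWeight m) (concat-padRows m R))

theorem4p1 : (m g : ℕ) → 1 ≤ m → 1 ≤ g →
    (μ : List ℕ) → IsPartition μ → length μ ≤ m → All (_≤ g) μ →
    Σ (Inverse (KingSetoid μ m) (SSOTSetoid g (complement m g μ) m))
      (λ Ψ → ∀ t → ssotWeight g m (Inverse.to Ψ t) ≡ kingWeight m t)
theorem4p1 m g _ _ μ pμ lμ bμ = Ψ m g μ pμ lμ bμ , Ψ-weight m g μ pμ lμ bμ
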